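{- Let $u_1=(1,\sqrt2,0,0)$, $u_2=(0,0,1,\sqrt2)$, $u_3=(-1,\sqrt2,-2,2\sqrt2)$, $u_4=(1,-\sqrt2,1,-\sqrt2)$ in $\mathbb{R}^4$. Then the cone $C$ generated by $\{u_1,\,u_1+u_2,\,u_3,\,u_3+u_4\}$ is not $(R,G)$-finitely generated, i.e. $C\cap\mathbb{Z}^4$ is not $(R,G)$-finitely generated.
   Context: $\mathrm{GL}(n,\mathbb{Z})$ is the group of integer $n\times n$ matrices with determinant $\pm1$. For a convex cone $C\subseteq\mathbb{R}^n$ let $S_C:=C\cap\mathbb{Z}^n$. $S_C$ is called $(R,G)$-finitely generated if there exist a finite subset $R\subseteq S_C$ and a finitely generated subgroup $G\subseteq\mathrm{GL}(n,\mathbb{Z})$ acting linearly on $C$ (written $x\mapsto T\cdot x$) such that (1) $G\cdot C=C$ and $G\cdot S_C=S_C$, and (2) every $s\in S_C$ can be written as a finite sum $s=\sum_{i}\lambda_i\,T_i\cdot r_i$ with $r_i\in R$, $T_i\in G$, $\lambda_i\in\mathbb{Z}_{\ge0}$. "Not $(R,G)$-finitely generated" means no such pair exists. -}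

module Defs where

open import Data.Nat using (ℕ)
open import Data.Fin using (Fin; zero; suc)
open import Data.Integer as ℤ using (ℤ; +_; -[1+_])
open import Data.Rational as ℚ using (ℚ; 0ℚ; 1ℚ)
open import Data.Product using (Σ; _×_; _,_; proj₁; proj₂; ∃)
open import Data.Sum using (_⊎_)
open import Data.List using (List; []; _∷_; length; lookup)
open import Data.List.Relation.Unary.All using (All)
open import Data.List.Membership.Propositional using (_∈_)
open import Relation.Binary.PropositionalEquality using (_≡_)

-- The real quadratic field K = ℚ(√2) ⊆ ℝ, element a + b√2 as a pair.

infix 4 _+√2·_

record K : Set where
  constructor _+√2·_
  field
    re : ℚ
    ir : ℚ
open K public

infixl 6 _+K_
infixl 7 _*K_

_+K_ : K → K → K
(a +√2· b) +K (c +√2· d) = (a ℚ.+ c) +√2· (b ℚ.+ d)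

_*K_ : K → K → K
(a +√2· b) *K (c +√2· d) =
  (a ℚ.* c ℚ.+ (ℤ.+ 2 ℚ./ 1) ℚ.* b ℚ.* d) +√2· (a ℚ.* d ℚ.+ b ℚ.* c)

-K_ : K → K
-K (a +√2· b) = ℚ.- a +√2· ℚ.- b

0K : K
0K = 0ℚ +√2· 0ℚ

ℤtoK : ℤ → K
ℤtoK z = (z ℚ./ 1) +√2· 0ℚ

√2 : K
√2 = 0ℚ +√2· 1ℚ

-- a + b√2 ≥ 0 (as a real number)
NonNegK : K → Set
NonNegK (a +√2· b) =
    (0ℚ ℚ.≤ a × 0ℚ ℚ.≤ b)
  ⊎ (0ℚ ℚ.≤ a × b ℚ.< 0ℚ × (ℤ.+ 2 ℚ./ 1) ℚ.* b ℚ.* b ℚ.≤ a ℚ.* a)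
  ⊎ (a ℚ.< 0ℚ × 0ℚ ℚ.< b × a ℚ.* a ℚ.≤ (ℤ.+ 2 ℚ./ 1) ℚ.* b ℚ.* b)

Vec4 : Set → Set
Vec4 A = Fin 4 → A

Mat : Set
Mat = Fin 4 → Fin 4 → ℤ

f0 f1 f2 f3 : Fin 4
f0 = zero
f1 = suc zero
f2 = suc (suc zero)
f3 = suc (suc (suc zero))

sum4ℤ : (Fin 4 → ℤ) → ℤ
sum4ℤ f = f f0 ℤ.+ f f1 ℤ.+ f f2 ℤ.+ f f3

sum4K : (Fin 4 → K) → K
sum4K f = f f0 +K f f1 +K f f2 +K f f3

_·M_ : Mat → Mat → Mat
(A ·M B) i j = sum4ℤ (λ k → A i k ℤ.* B k j)

δ : ∀ {n} → Fin n → Fin n → ℤ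
δ zero zero = ℤ.+ 1
δ (suc i) (suc j) = δ i j
δ zero (suc _) = ℤ.+ 0
δ (suc _) zero = ℤ.+ 0

idM : Mat
idM = δ

_·ℤ_ : Mat → Vec4 ℤ → Vec4 ℤ
(T ·ℤ x) i = sum4ℤ (λ k → T i k ℤ.* x k)

_·K_ : Mat → Vec4 K → Vec4 K
(T ·K x) i = sum4K (λ k → ℤtoK (T i k) *K x k)

embed : Vec4 ℤ → Vec4 K
embed x i = ℤtoK (x i)

_≈M_ : Mat → Mat → Set
A ≈M B = ∀ i j → A i j ≡ B i j

-- an element of GL(4,ℤ) given together with its integer inverse
IsInversePair : Mat × Mat → Set
IsInversePair (A , B) = ((A ·M B) ≈M idM) × ((B ·M A) ≈M idM)

data InGroup (gens : List (Mat × Mat)) : Mat → Set where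
  g-id  : InGroup gens idM
  g-gen : ∀ {p M} → p ∈ gens → InGroup gens M → InGroup gens (proj₁ p ·M M)
  g-inv : ∀ {p M} → p ∈ gens → InGroup gens M → InGroup gens (proj₂ p ·M M)

mkV : K → K → K → K → Vec4 K
mkV a b c d zero = a
mkV a b c d (suc zero) = b
mkV a b c d (suc (suc zero)) = c
mkV a b c d (suc (suc (suc zero))) = d

_+V_ : Vec4 K → Vec4 K → Vec4 K
(x +V y) i = x i +K y i

k : ℤ → K
k = ℤtoK

u₁ u₂ u₃ u₄ : Vec4 K
u₁ = mkV (k (ℤ.+ 1)) √2 (k (ℤ.+ 0)) (k (ℤ.+ 0))
u₂ = mkV (k (ℤ.+ 0)) (k (ℤ.+ 0)) (k (ℤ.+ 1)) √2
u₃ = mkV (k (ℤ.- (ℤ.+ 1))) √2 (k (ℤ.- (ℤ.+ 2))) (k (ℤ.+ 2) *K √2)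
u₄ = mkV (k (ℤ.+ 1)) (-K √2) (k (ℤ.+ 1)) (-K √2)

gen : Fin 4 → Vec4 K
gen zero = u₁
gen (suc zero) = u₁ +V u₂
gen (suc (suc zero)) = u₃
gen (suc (suc (suc zero))) = u₃ +V u₄

InC : Vec4 K → Set
InC x = Σ (Fin 4 → K) λ λs →
  (∀ j → NonNegK (λs j)) × (∀ i → x i ≡ sum4K (λ j → λs j *K gen j i))

InS : Vec4 ℤ → Set
InS x = InC (embed x)

sumTerms : List (ℕ × Mat × Vec4 ℤ) → Vec4 ℤ
sumTerms [] i = ℤ.+ 0
sumTerms ((l , T , r) ∷ ts) i = (ℤ.+ l) ℤ.* (T ·ℤ r) i ℤ.+ sumTerms ts i

record RGFinGen : Set where
  field
    R        : List (Vec4 ℤ)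
    R⊆S      : All InS R
    gens     : List (Mat × Mat)
    gensInv  : All IsInversePair gens
    GC⊆C     : ∀ T → InGroup gens T → ∀ x → InC x → InC (T ·K x)
    C⊆GC     : ∀ T → InGroup gens T → ∀ y → InC y →
               Σ (Vec4 K) λ x → InC x × (∀ i → (T ·K x) i ≡ y i)
    GS⊆S     : ∀ T → InGroup gens T → ∀ x → InS x → InS (T ·ℤ x)
    S⊆GS     : ∀ T → InGroup gens T → ∀ y → InS y →
               Σ (Vec4 ℤ) λ x → InS x × (∀ i → (T ·ℤ x) i ≡ y i)
    span     : ∀ s → InS s →
               Σ (List (ℕ × Mat × Vec4 ℤ)) λ ts →
                 All (λ t → InGroup gens (proj₁ (proj₂ t)) × proj₂ (proj₂ t) ∈ R) ts
                 × (∀ i → s i ≡ sumTerms ts i)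

{-# OPTIONS --safe #-}
module Submission where

-- Work in coordinates with respect to the generators of C; they lie in ℚ(√2).  If
-- T ∈ GL(4,ℤ) maps C onto itself, its matrix M in these coordinates is nonnegative and so
-- are the columns of M⁻¹, hence M is monomial.  Being rational, T commutes with the
-- conjugation √2 ↦ −√2; in these coordinates this leaves only finitely many values for the
-- ratio of the first two pivots of M.  Lattice points of C have x₁ ∈ ℕ, and x₁ = 0 only at 0,
-- so a point with x₁ = 1 is a single T · r, and the ratio of its first two coordinates is
-- determined by r ∈ R up to finitely many choices.  The Pell points (0, 1, −b, a) with
-- a² − 2b² = 1 lie in C and have pairwise different such ratios.

open import Level using (0ℓ)
open import Data.Unit using (tt)
open import Data.Empty using (⊥-elim)
open import Data.Nat as ℕ using (ℕ; zero; suc; z≤n; s≤s)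
import Data.Nat.Properties as ℕP
open import Data.Nat.Divisibility using (divides)
open import Data.Nat.Primality using (euclidsLemma; prime[2])
open import Data.Nat.Induction using (<-rec)
open import Data.Nat.Tactic.RingSolver as ℕ-Solver using ()
import Data.Nat.GCD as ℕGCD
open import Data.Fin as Fin using (Fin; zero; suc; punchIn; combine)
import Data.Fin.Properties as FinP
open import Data.Integer as ℤ using (ℤ; +_; ∣_∣)
import Data.Integer.Properties as ℤP
open import Data.Integer.GCD using (gcd)
open import Data.Integer.Tactic.RingSolver as ℤ-Solver using ()
open import Data.Rational as ℚ using (ℚ; mkℚ; 0ℚ; 1ℚ; ½; -½; _≤_; _<_)
import Data.Rational.Properties as ℚP
import Data.Rational.Unnormalised as ℚᵘ
import Data.Rational.Unnormalised.Properties as ℚᵘP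
open import Data.Rational.Solver using (module +-*-Solver)
open import Data.Product using (Σ; ∃; ∃₂; _×_; _,_; proj₁; proj₂)
open import Data.Sum using (_⊎_; inj₁; inj₂; [_,_]′)
open import Data.List as List using (List; []; _∷_; length)
open import Data.List.Relation.Unary.All as All using (All; []; _∷_)
open import Data.List.Relation.Unary.Any as Any using (Any; here; there)
open import Data.List.Relation.Unary.Any.Properties using (lookup-index)
open import Data.List.Membership.Propositional using (_∈_)
open import Data.Vec as Vec using (Vec; _∷_; [])
open import Data.Vec.Functional using (foldr)
open import Function using (id; _∘_)
open import Function.Definitions using (Injective)
open import Relation.Binary.PropositionalEquality
open import Relation.Binary.Definitions using (DecidableEquality; tri<; tri≈; tri>)
open import Relation.Nullary using (¬_; yes; no; contradiction)
open import Relation.Nullary.Decidable using (dec⇒maybe; map′; _×-dec_; toWitness)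
open import Tactic.RingSolver using (solve-∀)
open import Tactic.RingSolver.Core.AlmostCommutativeRing using (AlmostCommutativeRing; fromCommutativeRing)
open import Algebra.Bundles using (CommutativeRing)
open import Algebra.Properties.Group ℚP.+-0-group using () renaming (x∙y⁻¹≈ε⇒x≈y to ℚ-x-y≡0⇒x≡y)

open import Defs
open import Algebra.Structures {A = K} _≡_ using (IsCommutativeRing)

-- The field ℚ(√2)

ℚ-ring : AlmostCommutativeRing 0ℓ 0ℓ
ℚ-ring = fromCommutativeRing ℚP.+-*-commutativeRing (λ x → dec⇒maybe (0ℚ ℚP.≟ x))

2ℚ : ℚ
2ℚ = + 2 ℚ./ 1

1K : K
1K = 1ℚ +√2· 0ℚ

+K-assoc : ∀ x y z → (x +K y) +K z ≡ x +K (y +K z)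
+K-assoc (a +√2· b) (c +√2· d) (e +√2· f) = cong₂ _+√2·_ (ℚP.+-assoc a c e) (ℚP.+-assoc b d f)

+K-comm : ∀ x y → x +K y ≡ y +K x
+K-comm (a +√2· b) (c +√2· d) = cong₂ _+√2·_ (ℚP.+-comm a c) (ℚP.+-comm b d)

+K-identityˡ : ∀ x → 0K +K x ≡ x
+K-identityˡ (a +√2· b) = cong₂ _+√2·_ (ℚP.+-identityˡ a) (ℚP.+-identityˡ b)

+K-identityʳ : ∀ x → x +K 0K ≡ x
+K-identityʳ x = trans (+K-comm x 0K) (+K-identityˡ x)

-K-inverseˡ : ∀ x → (-K x) +K x ≡ 0K
-K-inverseˡ (a +√2· b) = cong₂ _+√2·_ (ℚP.+-inverseˡ a) (ℚP.+-inverseˡ b)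

-K-inverseʳ : ∀ x → x +K (-K x) ≡ 0K
-K-inverseʳ x = trans (+K-comm x (-K x)) (-K-inverseˡ x)

*K-comm : ∀ x y → x *K y ≡ y *K x
*K-comm (a +√2· b) (c +√2· d) = cong₂ _+√2·_ (re-comm a b c d) (ir-comm a b c d)
  where
  re-comm : ∀ a b c d → a ℚ.* c ℚ.+ 2ℚ ℚ.* b ℚ.* d ≡ c ℚ.* a ℚ.+ 2ℚ ℚ.* d ℚ.* b
  re-comm = solve-∀ ℚ-ring
  ir-comm : ∀ a b c d → a ℚ.* d ℚ.+ b ℚ.* c ≡ c ℚ.* b ℚ.+ d ℚ.* a
  ir-comm = solve-∀ ℚ-ring

*K-assoc : ∀ x y z → (x *K y) *K z ≡ x *K (y *K z)
*K-assoc (a +√2· b) (c +√2· d) (e +√2· f) = cong₂ _+√2·_ (re-assoc a b c d e f) (ir-assoc a b c d e f)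
  where
  re-assoc : ∀ a b c d e f →
    (a ℚ.* c ℚ.+ 2ℚ ℚ.* b ℚ.* d) ℚ.* e ℚ.+ 2ℚ ℚ.* (a ℚ.* d ℚ.+ b ℚ.* c) ℚ.* f ≡
    a ℚ.* (c ℚ.* e ℚ.+ 2ℚ ℚ.* d ℚ.* f) ℚ.+ 2ℚ ℚ.* b ℚ.* (c ℚ.* f ℚ.+ d ℚ.* e)
  re-assoc = solve-∀ ℚ-ring
  ir-assoc : ∀ a b c d e f →
    (a ℚ.* c ℚ.+ 2ℚ ℚ.* b ℚ.* d) ℚ.* f ℚ.+ (a ℚ.* d ℚ.+ b ℚ.* c) ℚ.* e ≡
    a ℚ.* (c ℚ.* f ℚ.+ d ℚ.* e) ℚ.+ b ℚ.* (c ℚ.* e ℚ.+ 2ℚ ℚ.* d ℚ.* f)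
  ir-assoc = solve-∀ ℚ-ring

*K-identityˡ : ∀ x → 1K *K x ≡ x
*K-identityˡ (a +√2· b) = cong₂ _+√2·_ (re-identity a b) (ir-identity a b)
  where
  re-identity : ∀ a b → 1ℚ ℚ.* a ℚ.+ 2ℚ ℚ.* 0ℚ ℚ.* b ≡ a
  re-identity = solve-∀ ℚ-ring
  ir-identity : ∀ a b → 1ℚ ℚ.* b ℚ.+ 0ℚ ℚ.* a ≡ b
  ir-identity = solve-∀ ℚ-ring

*K-identityʳ : ∀ x → x *K 1K ≡ x
*K-identityʳ x = trans (*K-comm x 1K) (*K-identityˡ x)

*K-distribˡ : ∀ x y z → x *K (y +K z) ≡ x *K y +K x *K z
*K-distribˡ (a +√2· b) (c +√2· d) (e +√2· f) = cong₂ _+√2·_ (re-distrib a b c d e f) (ir-distrib a b c d e f)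
  where
  re-distrib : ∀ a b c d e f →
    a ℚ.* (c ℚ.+ e) ℚ.+ 2ℚ ℚ.* b ℚ.* (d ℚ.+ f) ≡
    (a ℚ.* c ℚ.+ 2ℚ ℚ.* b ℚ.* d) ℚ.+ (a ℚ.* e ℚ.+ 2ℚ ℚ.* b ℚ.* f)
  re-distrib = solve-∀ ℚ-ring
  ir-distrib : ∀ a b c d e f →
    a ℚ.* (d ℚ.+ f) ℚ.+ b ℚ.* (c ℚ.+ e) ≡ (a ℚ.* d ℚ.+ b ℚ.* c) ℚ.+ (a ℚ.* f ℚ.+ b ℚ.* e)
  ir-distrib = solve-∀ ℚ-ring

*K-distribʳ : ∀ x y z → (y +K z) *K x ≡ y *K x +K z *K x
*K-distribʳ x y z = begin
  (y +K z) *K x      ≡⟨ *K-comm (y +K z) x ⟩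
  x *K (y +K z)      ≡⟨ *K-distribˡ x y z ⟩
  x *K y +K x *K z   ≡⟨ cong₂ _+K_ (*K-comm x y) (*K-comm x z) ⟩
  y *K x +K z *K x   ∎
  where open ≡-Reasoning

_≟K_ : DecidableEquality K
(a +√2· b) ≟K (c +√2· d) =
  map′ (λ (p , q) → cong₂ _+√2·_ p q) (λ e → cong re e , cong ir e) ((a ℚP.≟ c) ×-dec (b ℚP.≟ d))

K-isCommutativeRing : IsCommutativeRing _+K_ _*K_ -K_ 0K 1K
K-isCommutativeRing = record
  { isRing = record
    { +-isAbelianGroup = record
      { isGroup = record
        { isMonoid = record
          { isSemigroup = record
            { isMagma = record { isEquivalence = isEquivalence ; ∙-cong = cong₂ _+K_ }
            ; assoc = +K-assoc }
          ; identity = +K-identityˡ , +K-identityʳ }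
        ; inverse = -K-inverseˡ , -K-inverseʳ
        ; ⁻¹-cong = cong -K_ }
      ; comm = +K-comm }
    ; *-cong = cong₂ _*K_
    ; *-assoc = *K-assoc
    ; *-identity = *K-identityˡ , *K-identityʳ
    ; distrib = *K-distribˡ , *K-distribʳ }
  ; *-comm = *K-comm }

K-commutativeRing : CommutativeRing 0ℓ 0ℓ
K-commutativeRing = record { isCommutativeRing = K-isCommutativeRing }

K-ring : AlmostCommutativeRing 0ℓ 0ℓ
K-ring = fromCommutativeRing K-commutativeRing (λ x → dec⇒maybe (0K ≟K x))

*K-zeroˡ : ∀ x → 0K *K x ≡ 0K
*K-zeroˡ = solve-∀ K-ring

*K-zeroʳ : ∀ x → x *K 0K ≡ 0K
*K-zeroʳ = solve-∀ K-ring

1K≢0K : 1K ≢ 0K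
1K≢0K 1≡0 = ℚP.1≢0 (cong re 1≡0)

fromℤ : ℤ → ℚ
fromℤ z = z ℚ./ 1

fromℚ : ℚ → K
fromℚ q = q +√2· 0ℚ

private
  fromℤ-toℚᵘ : ∀ z → ℚ.toℚᵘ (fromℤ z) ℚᵘ.≃ ℚᵘ.mkℚᵘ z 0
  fromℤ-toℚᵘ z = ℚP.toℚᵘ-fromℚᵘ (ℚᵘ.mkℚᵘ z 0)

fromℤ-+ : ∀ x y → fromℤ (x ℤ.+ y) ≡ fromℤ x ℚ.+ fromℤ y
fromℤ-+ x y = trans (ℚP.fromℚᵘ-cong (ℚᵘP.≃-sym unnormalised)) (ℚP.fromℚᵘ-toℚᵘ (fromℤ x ℚ.+ fromℤ y))
  where
  cross-multiplied : ∀ x y → (x ℤ.* + 1 ℤ.+ y ℤ.* + 1) ℤ.* + 1 ≡ (x ℤ.+ y) ℤ.* + 1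
  cross-multiplied = ℤ-Solver.solve-∀
  unnormalised : ℚ.toℚᵘ (fromℤ x ℚ.+ fromℤ y) ℚᵘ.≃ ℚᵘ.mkℚᵘ (x ℤ.+ y) 0
  unnormalised = ℚᵘP.≃-trans (ℚP.toℚᵘ-homo-+ (fromℤ x) (fromℤ y))
    (ℚᵘP.≃-trans (ℚᵘP.+-cong (fromℤ-toℚᵘ x) (fromℤ-toℚᵘ y)) (ℚᵘ.*≡* (cross-multiplied x y)))

fromℤ-* : ∀ x y → fromℤ (x ℤ.* y) ≡ fromℤ x ℚ.* fromℤ y
fromℤ-* x y = trans (ℚP.fromℚᵘ-cong (ℚᵘP.≃-sym unnormalised)) (ℚP.fromℚᵘ-toℚᵘ (fromℤ x ℚ.* fromℤ y))
  where
  unnormalised : ℚ.toℚᵘ (fromℤ x ℚ.* fromℤ y) ℚᵘ.≃ ℚᵘ.mkℚᵘ (x ℤ.* y) 0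
  unnormalised = ℚᵘP.≃-trans (ℚP.toℚᵘ-homo-* (fromℤ x) (fromℤ y))
    (ℚᵘP.≃-trans (ℚᵘP.*-cong (fromℤ-toℚᵘ x) (fromℤ-toℚᵘ y)) (ℚᵘ.*≡* refl))

↥-fromℤ : ∀ z → ℚ.numerator (fromℤ z) ≡ z
↥-fromℤ z = begin
  ℚ.numerator (fromℤ z)                        ≡⟨ ℤP.*-identityʳ _ ⟨
  ℚ.numerator (fromℤ z) ℤ.* + 1                ≡⟨ cong (λ g → ℚ.numerator (fromℤ z) ℤ.* + g) (ℕGCD.gcd-zeroʳ ℤ.∣ z ∣) ⟨
  ℚ.numerator (fromℤ z) ℤ.* gcd z (+ 1)        ≡⟨ ℚP.↥-/ z 1 ⟩
  z                                            ∎
  where open ≡-Reasoning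

fromℤ-injective : ∀ {x y} → fromℤ x ≡ fromℤ y → x ≡ y
fromℤ-injective {x} {y} e = trans (sym (↥-fromℤ x)) (trans (cong ℚ.numerator e) (↥-fromℤ y))

fromℤ-nonNeg⁻¹ : ∀ {z} → 0ℚ ℚ.≤ fromℤ z → + 0 ℤ.≤ z
fromℤ-nonNeg⁻¹ {z} (ℚ.*≤* 0≤↥) = subst (+ 0 ℤ.≤_) (trans (ℤP.*-identityʳ _) (↥-fromℤ z)) 0≤↥

fromℤ-neg : ∀ n → fromℤ (ℤ.- (+ n)) ≡ ℚ.- fromℤ (+ n)
fromℤ-neg zero = refl
fromℤ-neg (suc n) = refl

fromℤ-nonNeg : ∀ n → 0ℚ ℚ.≤ fromℤ (+ n)
fromℤ-nonNeg n = ℚP.nonNegative⁻¹ _ {{ℚP.normalize-nonNeg n 1}}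

ℤtoK-+ : ∀ x y → ℤtoK (x ℤ.+ y) ≡ ℤtoK x +K ℤtoK y
ℤtoK-+ x y = cong₂ _+√2·_ (fromℤ-+ x y) refl

ℤtoK-* : ∀ x y → ℤtoK (x ℤ.* y) ≡ ℤtoK x *K ℤtoK y
ℤtoK-* x y = cong₂ _+√2·_ (trans (fromℤ-* x y) (re-part (fromℤ x) (fromℤ y))) (ir-part (fromℤ x) (fromℤ y))
  where
  re-part : ∀ a c → a ℚ.* c ≡ a ℚ.* c ℚ.+ 2ℚ ℚ.* 0ℚ ℚ.* 0ℚ
  re-part = solve-∀ ℚ-ring
  ir-part : ∀ a c → 0ℚ ≡ a ℚ.* 0ℚ ℚ.+ 0ℚ ℚ.* c
  ir-part = solve-∀ ℚ-ring

-- Irrationality of √2, conjugation and norm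

halve-√2 : ∀ m n → m ℕ.* m ≡ 2 ℕ.* (n ℕ.* n) → ∃ λ q → m ≡ 2 ℕ.* q × n ℕ.* n ≡ 2 ℕ.* (q ℕ.* q)
halve-√2 m n eq with [ id , id ]′ (euclidsLemma m m prime[2] (divides (n ℕ.* n) (trans eq (ℕP.*-comm 2 (n ℕ.* n)))))
... | divides q refl = q , ℕP.*-comm q 2 , ℕP.*-cancelˡ-≡ _ _ 2 (sym (trans (four-squares q) eq))
  where
  four-squares : ∀ q → 2 ℕ.* (2 ℕ.* (q ℕ.* q)) ≡ (q ℕ.* 2) ℕ.* (q ℕ.* 2)
  four-squares = ℕ-Solver.solve-∀

√2-irrationalℕ : ∀ m n → m ℕ.* m ≡ 2 ℕ.* (n ℕ.* n) → n ≡ 0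
√2-irrationalℕ = <-rec (λ m → ∀ n → m ℕ.* m ≡ 2 ℕ.* (n ℕ.* n) → n ≡ 0) descent
  where
  descent : ∀ m → (∀ {m'} → m' ℕ.< m → ∀ n → m' ℕ.* m' ≡ 2 ℕ.* (n ℕ.* n) → n ≡ 0) →
            ∀ n → m ℕ.* m ≡ 2 ℕ.* (n ℕ.* n) → n ≡ 0
  descent m rec n eq with halve-√2 m n eq
  ... | zero , _ , n²≡0 = [ id , id ]′ (ℕP.m*n≡0⇒m≡0∨n≡0 n n²≡0)
  ... | q@(suc _) , m≡2q , n²≡2q² with halve-√2 n q n²≡2q²
  ...   | r , n≡2r , q²≡2r² = trans n≡2r (cong (2 ℕ.*_) (rec q<m r q²≡2r²))
    where
    q<m : q ℕ.< m
    q<m = subst (q ℕ.<_) (sym m≡2q) (ℕP.m<m+n q (s≤s z≤n))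

√2-irrational : ∀ a b → a ℚ.* a ≡ 2ℚ ℚ.* (b ℚ.* b) → b ≡ 0ℚ
√2-irrational a@(mkℚ na da-1 _) b@(mkℚ nb db-1 _) eq =
  ℚP.↥p≡0⇒p≡0 b (ℤP.∣i∣≡0⇒i≡0 ∣nb∣≡0)
  where
  da db : ℕ
  da = suc da-1
  db = suc db-1
  unnormalised : ℚ.toℚᵘ a ℚᵘ.* ℚ.toℚᵘ a ℚᵘ.≃ ℚ.toℚᵘ 2ℚ ℚᵘ.* (ℚ.toℚᵘ b ℚᵘ.* ℚ.toℚᵘ b)
  unnormalised = begin
    ℚ.toℚᵘ a ℚᵘ.* ℚ.toℚᵘ a                   ≈⟨ ℚP.toℚᵘ-homo-* a a ⟨
    ℚ.toℚᵘ (a ℚ.* a)                          ≡⟨ cong ℚ.toℚᵘ eq ⟩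
    ℚ.toℚᵘ (2ℚ ℚ.* (b ℚ.* b))                 ≈⟨ ℚP.toℚᵘ-homo-* 2ℚ (b ℚ.* b) ⟩
    ℚ.toℚᵘ 2ℚ ℚᵘ.* ℚ.toℚᵘ (b ℚ.* b)           ≈⟨ ℚᵘP.*-congˡ {ℚ.toℚᵘ 2ℚ} (ℚP.toℚᵘ-homo-* b b) ⟩
    ℚ.toℚᵘ 2ℚ ℚᵘ.* (ℚ.toℚᵘ b ℚᵘ.* ℚ.toℚᵘ b)  ∎
    where open ℚᵘP.≃-Reasoning
  cleared : (na ℤ.* na) ℤ.* (+ 1 ℤ.* (+ db ℤ.* + db)) ≡ (+ 2 ℤ.* (nb ℤ.* nb)) ℤ.* (+ da ℤ.* + da)
  cleared with unnormalised
  ... | ℚᵘ.*≡* e = e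
  cleared-ℕ : (∣ na ∣ ℕ.* db) ℕ.* (∣ na ∣ ℕ.* db) ≡ 2 ℕ.* ((∣ nb ∣ ℕ.* da) ℕ.* (∣ nb ∣ ℕ.* da))
  cleared-ℕ = begin
    (∣ na ∣ ℕ.* db) ℕ.* (∣ na ∣ ℕ.* db)             ≡⟨ regroupˡ ∣ na ∣ db ⟩
    (∣ na ∣ ℕ.* ∣ na ∣) ℕ.* (1 ℕ.* (db ℕ.* db))      ≡⟨ cong₂ ℕ._*_ (ℤP.abs-* na na) refl ⟨
    ∣ na ℤ.* na ∣ ℕ.* (1 ℕ.* (db ℕ.* db))            ≡⟨ ℤP.abs-* (na ℤ.* na) _ ⟨
    ∣ (na ℤ.* na) ℤ.* (+ 1 ℤ.* (+ db ℤ.* + db)) ∣    ≡⟨ cong ∣_∣ cleared ⟩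
    ∣ (+ 2 ℤ.* (nb ℤ.* nb)) ℤ.* (+ da ℤ.* + da) ∣    ≡⟨ ℤP.abs-* (+ 2 ℤ.* (nb ℤ.* nb)) _ ⟩
    ∣ + 2 ℤ.* (nb ℤ.* nb) ∣ ℕ.* (da ℕ.* da)          ≡⟨ cong₂ ℕ._*_ (ℤP.abs-* (+ 2) (nb ℤ.* nb)) refl ⟩
    2 ℕ.* ∣ nb ℤ.* nb ∣ ℕ.* (da ℕ.* da)              ≡⟨ cong (λ x → 2 ℕ.* x ℕ.* (da ℕ.* da)) (ℤP.abs-* nb nb) ⟩
    2 ℕ.* (∣ nb ∣ ℕ.* ∣ nb ∣) ℕ.* (da ℕ.* da)        ≡⟨ regroupʳ ∣ nb ∣ da ⟩
    2 ℕ.* ((∣ nb ∣ ℕ.* da) ℕ.* (∣ nb ∣ ℕ.* da))     ∎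
    where
    open ≡-Reasoning
    regroupˡ : ∀ x y → (x ℕ.* y) ℕ.* (x ℕ.* y) ≡ (x ℕ.* x) ℕ.* (1 ℕ.* (y ℕ.* y))
    regroupˡ = ℕ-Solver.solve-∀
    regroupʳ : ∀ x y → 2 ℕ.* (x ℕ.* x) ℕ.* (y ℕ.* y) ≡ 2 ℕ.* ((x ℕ.* y) ℕ.* (x ℕ.* y))
    regroupʳ = ℕ-Solver.solve-∀
  ∣nb∣≡0 : ∣ nb ∣ ≡ 0
  ∣nb∣≡0 = ℕP.m*n≡0⇒m≡0 ∣ nb ∣ da (√2-irrationalℕ (∣ na ∣ ℕ.* db) (∣ nb ∣ ℕ.* da) cleared-ℕ)

conj : K → K
conj (a +√2· b) = a +√2· ℚ.- b

conj-+K : ∀ x y → conj (x +K y) ≡ conj x +K conj y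
conj-+K (a +√2· b) (c +√2· d) = cong (a ℚ.+ c +√2·_) (ℚP.neg-distrib-+ b d)

conj-*K : ∀ x y → conj (x *K y) ≡ conj x *K conj y
conj-*K (a +√2· b) (c +√2· d) = cong₂ _+√2·_ (re-part a b c d) (ir-part a b c d)
  where
  re-part : ∀ a b c d → a ℚ.* c ℚ.+ 2ℚ ℚ.* b ℚ.* d ≡ a ℚ.* c ℚ.+ 2ℚ ℚ.* (ℚ.- b) ℚ.* (ℚ.- d)
  re-part = solve-∀ ℚ-ring
  ir-part : ∀ a b c d → ℚ.- (a ℚ.* d ℚ.+ b ℚ.* c) ≡ a ℚ.* (ℚ.- d) ℚ.+ (ℚ.- b) ℚ.* c
  ir-part = solve-∀ ℚ-ring

conj≡0K⇒≡0K : ∀ x → conj x ≡ 0K → x ≡ 0K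
conj≡0K⇒≡0K (a +√2· b) e = cong₂ _+√2·_ (cong re e) (ℚP.neg-injective (cong ir e))

norm : K → ℚ
norm (a +√2· b) = a ℚ.* a ℚ.- 2ℚ ℚ.* b ℚ.* b

*K-conj : ∀ x → x *K conj x ≡ fromℚ (norm x)
*K-conj (a +√2· b) = cong₂ _+√2·_ (re-part a b) (ir-part a b)
  where
  re-part : ∀ a b → a ℚ.* a ℚ.+ 2ℚ ℚ.* b ℚ.* (ℚ.- b) ≡ a ℚ.* a ℚ.- 2ℚ ℚ.* b ℚ.* b
  re-part = solve-∀ ℚ-ring
  ir-part : ∀ a b → a ℚ.* (ℚ.- b) ℚ.+ b ℚ.* a ≡ 0ℚ
  ir-part = solve-∀ ℚ-ring

norm-*K : ∀ x y → norm (x *K y) ≡ norm x ℚ.* norm y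
norm-*K (a +√2· b) (c +√2· d) = multiplicative a b c d
  where
  multiplicative : ∀ a b c d →
    (a ℚ.* c ℚ.+ 2ℚ ℚ.* b ℚ.* d) ℚ.* (a ℚ.* c ℚ.+ 2ℚ ℚ.* b ℚ.* d) ℚ.- 2ℚ ℚ.* (a ℚ.* d ℚ.+ b ℚ.* c) ℚ.* (a ℚ.* d ℚ.+ b ℚ.* c)
    ≡ (a ℚ.* a ℚ.- 2ℚ ℚ.* b ℚ.* b) ℚ.* (c ℚ.* c ℚ.- 2ℚ ℚ.* d ℚ.* d)
  multiplicative = solve-∀ ℚ-ring

square≡0⇒≡0 : ∀ a → a ℚ.* a ≡ 0ℚ → a ≡ 0ℚ
square≡0⇒≡0 a a²≡0 = √2-irrational 0ℚ a (sym (cong (2ℚ ℚ.*_) a²≡0))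

norm≡0⇒≡0K : ∀ x → norm x ≡ 0ℚ → x ≡ 0K
norm≡0⇒≡0K (a +√2· b) norm≡0 = cong₂ _+√2·_ a≡0 b≡0
  where
  b≡0 : b ≡ 0ℚ
  b≡0 = √2-irrational a b (trans (ℚ-x-y≡0⇒x≡y _ _ norm≡0) (ℚP.*-assoc 2ℚ b b))
  a≡0 : a ≡ 0ℚ
  a≡0 = square≡0⇒≡0 a (begin
    a ℚ.* a                               ≡⟨ ℚP.+-identityʳ (a ℚ.* a) ⟨
    a ℚ.* a ℚ.- 2ℚ ℚ.* 0ℚ ℚ.* 0ℚ          ≡⟨ cong (λ b → a ℚ.* a ℚ.- 2ℚ ℚ.* b ℚ.* b) b≡0 ⟨
    a ℚ.* a ℚ.- 2ℚ ℚ.* b ℚ.* b            ≡⟨ norm≡0 ⟩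
    0ℚ                                    ∎)
    where open ≡-Reasoning

ℚ-p*q≡0⇒p≡0 : ∀ p q → q ≢ 0ℚ → p ℚ.* q ≡ 0ℚ → p ≡ 0ℚ
ℚ-p*q≡0⇒p≡0 p q q≢0 pq≡0 = begin
  p                        ≡⟨ ℚP.*-identityʳ p ⟨
  p ℚ.* 1ℚ                 ≡⟨ cong (p ℚ.*_) (ℚP.*-inverseʳ q) ⟨
  p ℚ.* (q ℚ.* q⁻¹)        ≡⟨ ℚP.*-assoc p q q⁻¹ ⟨
  (p ℚ.* q) ℚ.* q⁻¹        ≡⟨ cong (ℚ._* q⁻¹) pq≡0 ⟩
  0ℚ ℚ.* q⁻¹               ≡⟨ ℚP.*-zeroˡ q⁻¹ ⟩
  0ℚ                       ∎
  where
  open ≡-Reasoning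
  instance
    q-nonZero : ℚ.NonZero q
    q-nonZero = ℚ.≢-nonZero q≢0
  q⁻¹ : ℚ
  q⁻¹ = ℚ.1/ q

x*y≡0⇒x≡0 : ∀ x y → y ≢ 0K → x *K y ≡ 0K → x ≡ 0K
x*y≡0⇒x≡0 x y y≢0 xy≡0 = norm≡0⇒≡0K x (ℚ-p*q≡0⇒p≡0 (norm x) (norm y) (y≢0 ∘ norm≡0⇒≡0K y) (begin
  norm x ℚ.* norm y   ≡⟨ norm-*K x y ⟨
  norm (x *K y)       ≡⟨ cong norm xy≡0 ⟩
  0ℚ                  ∎))
  where open ≡-Reasoning

*K-cancelˡ : ∀ z {x y} → z ≢ 0K → z *K x ≡ z *K y → x ≡ y
*K-cancelˡ z {x} {y} z≢0 zx≡zy = begin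
  x                      ≡⟨ split x y ⟩
  (x +K -K y) +K y       ≡⟨ cong (_+K y) (x*y≡0⇒x≡0 (x +K -K y) z z≢0 difference≡0) ⟩
  0K +K y                ≡⟨ +K-identityˡ y ⟩
  y                      ∎
  where
  open ≡-Reasoning
  split : ∀ x y → x ≡ (x +K -K y) +K y
  split = solve-∀ K-ring
  factor : ∀ x y z → (x +K -K y) *K z ≡ z *K x +K -K (z *K y)
  factor = solve-∀ K-ring
  difference≡0 : (x +K -K y) *K z ≡ 0K
  difference≡0 = trans (factor x y z) (trans (cong (λ t → t +K -K (z *K y)) zx≡zy) (-K-inverseʳ (z *K y)))

*K-≢0 : ∀ {x y} → x ≢ 0K → y ≢ 0K → x *K y ≢ 0K
*K-≢0 {x} {y} x≢0 y≢0 = x≢0 ∘ x*y≡0⇒x≡0 x y y≢0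

√2*fromℚ≡fromℚ⇒≡0 : ∀ {p q} → √2 *K fromℚ p ≡ fromℚ q → p ≡ 0ℚ
√2*fromℚ≡fromℚ⇒≡0 {p} √2p≡q = trans (sym (ir-part p)) (cong ir √2p≡q)
  where
  ir-part : ∀ p → 0ℚ ℚ.* 0ℚ ℚ.+ 1ℚ ℚ.* p ≡ p
  ir-part = solve-∀ ℚ-ring

-- The ordering of ℚ(√2)

+-nonNeg : ∀ {p q} → 0ℚ ≤ p → 0ℚ ≤ q → 0ℚ ≤ p ℚ.+ q
+-nonNeg 0≤p 0≤q = ℚP.+-mono-≤ 0≤p 0≤q

*-nonNeg : ∀ {p q} → 0ℚ ≤ p → 0ℚ ≤ q → 0ℚ ≤ p ℚ.* q
*-nonNeg {p} {q} 0≤p 0≤q =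
  ℚP.nonNegative⁻¹ _ {{ℚP.nonNeg*nonNeg⇒nonNeg p {{ℚ.nonNegative 0≤p}} q {{ℚ.nonNegative 0≤q}}}}

neg-nonNeg : ∀ {p} → p ≤ 0ℚ → 0ℚ ≤ ℚ.- p
neg-nonNeg = ℚP.neg-antimono-≤

square-nonNeg : ∀ p → 0ℚ ≤ p ℚ.* p
square-nonNeg p with ℚP.≤-total 0ℚ p
... | inj₁ 0≤p = *-nonNeg 0≤p 0≤p
... | inj₂ p≤0 = subst (0ℚ ≤_) (neg-square p) (*-nonNeg (neg-nonNeg p≤0) (neg-nonNeg p≤0))
  where
  neg-square : ∀ p → ℚ.- p ℚ.* ℚ.- p ≡ p ℚ.* p
  neg-square = solve-∀ ℚ-ring

2ℚ-nonNeg : 0ℚ ≤ 2ℚ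
2ℚ-nonNeg = ℚP.nonNegative⁻¹ 2ℚ

≤⇒-nonNeg : ∀ {p q} → p ≤ q → 0ℚ ≤ q ℚ.- p
≤⇒-nonNeg {p} {q} p≤q = subst (_≤ q ℚ.- p) (ℚP.+-inverseʳ p) (ℚP.+-monoˡ-≤ (ℚ.- p) p≤q)

-nonNeg⇒≤ : ∀ {p q} → 0ℚ ≤ q ℚ.- p → p ≤ q
-nonNeg⇒≤ {p} {q} 0≤q-p = subst₂ _≤_ (ℚP.+-identityˡ p) (cancel p q) (ℚP.+-monoˡ-≤ p 0≤q-p)
  where
  cancel : ∀ p q → q ℚ.- p ℚ.+ p ≡ q
  cancel = solve-∀ ℚ-ring

nonNeg-antisym : ∀ {p} → 0ℚ ≤ p → 0ℚ ≤ ℚ.- p → p ≡ 0ℚ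
nonNeg-antisym {p} 0≤p 0≤-p = ℚP.≤-antisym (-nonNeg⇒≤ (subst (0ℚ ≤_) (zero-minus p) 0≤-p)) 0≤p
  where
  zero-minus : ∀ p → ℚ.- p ≡ 0ℚ ℚ.- p
  zero-minus = solve-∀ ℚ-ring

nonNeg∧≢0⇒pos : ∀ {p} → 0ℚ ≤ p → p ≢ 0ℚ → 0ℚ < p
nonNeg∧≢0⇒pos {p} 0≤p p≢0 with ℚP.<-cmp 0ℚ p
... | tri< 0<p _ _ = 0<p
... | tri≈ _ 0≡p _ = contradiction (sym 0≡p) p≢0
... | tri> _ _ p<0 = contradiction (ℚP.<-≤-trans p<0 0≤p) (ℚP.<-irrefl refl)

square-mono⁻¹ : ∀ {p q} → 0ℚ ≤ q → p ℚ.* p ≤ q ℚ.* q → p ≤ q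
square-mono⁻¹ {p} {q} 0≤q p²≤q² with p ℚP.≤? q
... | yes p≤q = p≤q
... | no p≰q = contradiction (ℚP.<-≤-trans q²<p² p²≤q²) (ℚP.<-irrefl refl)
  where
  q<p : q < p
  q<p = ℚP.≰⇒> p≰q
  q²<p² : q ℚ.* q < p ℚ.* p
  q²<p² = ℚP.≤-<-trans (ℚP.*-monoˡ-≤-nonNeg q {{ℚ.nonNegative 0≤q}} (ℚP.<⇒≤ q<p))
            (ℚP.*-monoˡ-<-pos p {{ℚ.positive (ℚP.≤-<-trans 0≤q q<p)}} q<p)

square-pos : ∀ {r} → 0ℚ < r → 0ℚ < r ℚ.* r
square-pos {r} 0<r = ℚP.positive⁻¹ _ {{ℚP.pos*pos⇒pos r {{ℚ.positive 0<r}} r {{ℚ.positive 0<r}}}}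

*-nonNeg-cancelˡ : ∀ {r p} → 0ℚ < r → 0ℚ ≤ r ℚ.* p → 0ℚ ≤ p
*-nonNeg-cancelˡ {r} {p} 0<r 0≤rp = ℚP.*-cancelˡ-≤-pos r {{ℚ.positive 0<r}} (subst (_≤ r ℚ.* p) (sym (ℚP.*-zeroʳ r)) 0≤rp)

+-nonNeg-dominated : ∀ u v → 0ℚ ≤ u → 0ℚ ≤ u ℚ.* u ℚ.- v ℚ.* v → 0ℚ ≤ u ℚ.+ v
+-nonNeg-dominated u v 0≤u 0≤u²-v² =
  subst (0ℚ ≤_) (minus-neg u v) (≤⇒-nonNeg (square-mono⁻¹ 0≤u (-nonNeg⇒≤ (subst (0ℚ ≤_) (neg-square u v) 0≤u²-v²))))
  where
  minus-neg : ∀ u v → u ℚ.- ℚ.- v ≡ u ℚ.+ v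
  minus-neg = solve-∀ ℚ-ring
  neg-square : ∀ u v → u ℚ.* u ℚ.- v ℚ.* v ≡ u ℚ.* u ℚ.- ℚ.- v ℚ.* ℚ.- v
  neg-square = solve-∀ ℚ-ring

-- a + b√2 ≥ 0, split by the sign of a² − 2b²: whichever of a and b√2 dominates must be ≥ 0.
data NonNeg : K → Set where
  re-dominant : ∀ {a b} → 0ℚ ≤ a → 0ℚ ≤ norm (a +√2· b) → NonNeg (a +√2· b)
  ir-dominant : ∀ {a b} → 0ℚ ≤ b → 0ℚ ≤ ℚ.- norm (a +√2· b) → NonNeg (a +√2· b)

private
  flip-norm : ∀ a b → 2ℚ ℚ.* b ℚ.* b ℚ.- a ℚ.* a ≡ ℚ.- (a ℚ.* a ℚ.- 2ℚ ℚ.* b ℚ.* b)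
  flip-norm = solve-∀ ℚ-ring

NonNegK⇒NonNeg : ∀ {x} → NonNegK x → NonNeg x
NonNegK⇒NonNeg {a +√2· b} (inj₁ (0≤a , 0≤b)) with 0ℚ ℚP.≤? norm (a +√2· b)
... | yes 0≤N = re-dominant 0≤a 0≤N
... | no 0≰N = ir-dominant 0≤b (neg-nonNeg (ℚP.<⇒≤ (ℚP.≰⇒> 0≰N)))
NonNegK⇒NonNeg {a +√2· b} (inj₂ (inj₁ (0≤a , _ , 2b²≤a²))) = re-dominant 0≤a (≤⇒-nonNeg 2b²≤a²)
NonNegK⇒NonNeg {a +√2· b} (inj₂ (inj₂ (_ , 0<b , a²≤2b²))) =
  ir-dominant (ℚP.<⇒≤ 0<b) (subst (0ℚ ≤_) (flip-norm a b) (≤⇒-nonNeg a²≤2b²))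

NonNeg⇒NonNegK : ∀ {x} → NonNeg x → NonNegK x
NonNeg⇒NonNegK {a +√2· b} (re-dominant 0≤a 0≤N) with 0ℚ ℚP.≤? b
... | yes 0≤b = inj₁ (0≤a , 0≤b)
... | no 0≰b = inj₂ (inj₁ (0≤a , ℚP.≰⇒> 0≰b , -nonNeg⇒≤ 0≤N))
NonNeg⇒NonNegK {a +√2· b} (ir-dominant 0≤b 0≤-N) with 0ℚ ℚP.≤? a
... | yes 0≤a = inj₁ (0≤a , 0≤b)
... | no 0≰a = inj₂ (inj₂ (ℚP.≰⇒> 0≰a , nonNeg∧≢0⇒pos 0≤b b≢0 , -nonNeg⇒≤ (subst (0ℚ ≤_) (sym (flip-norm a b)) 0≤-N)))
  where
  b≢0 : b ≢ 0ℚ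
  b≢0 refl = 0≰a (ℚP.≤-reflexive (sym (square≡0⇒≡0 a (nonNeg-antisym (square-nonNeg a) (subst (λ t → 0ℚ ≤ ℚ.- t) (ℚP.+-identityʳ (a ℚ.* a)) 0≤-N)))))

NonNeg-*K : ∀ {x y} → NonNeg x → NonNeg y → NonNeg (x *K y)
NonNeg-*K {x@(a +√2· b)} {y@(c +√2· d)} (re-dominant 0≤a 0≤M) (re-dominant 0≤c 0≤N) =
  re-dominant (+-nonNeg-dominated (a ℚ.* c) (2ℚ ℚ.* b ℚ.* d) (*-nonNeg 0≤a 0≤c) (subst (0ℚ ≤_) (identity a b c d)
                 (+-nonNeg (+-nonNeg (*-nonNeg 0≤M 0≤N) (*-nonNeg (*-nonNeg 2ℚ-nonNeg 0≤M) (square-nonNeg d)))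
                           (*-nonNeg (*-nonNeg 2ℚ-nonNeg 0≤N) (square-nonNeg b)))))
              (subst (0ℚ ≤_) (sym (norm-*K x y)) (*-nonNeg 0≤M 0≤N))
  where
  identity : ∀ a b c d →
    (a ℚ.* a ℚ.- 2ℚ ℚ.* b ℚ.* b) ℚ.* (c ℚ.* c ℚ.- 2ℚ ℚ.* d ℚ.* d)
      ℚ.+ 2ℚ ℚ.* (a ℚ.* a ℚ.- 2ℚ ℚ.* b ℚ.* b) ℚ.* (d ℚ.* d) ℚ.+ 2ℚ ℚ.* (c ℚ.* c ℚ.- 2ℚ ℚ.* d ℚ.* d) ℚ.* (b ℚ.* b)
    ≡ a ℚ.* c ℚ.* (a ℚ.* c) ℚ.- 2ℚ ℚ.* b ℚ.* d ℚ.* (2ℚ ℚ.* b ℚ.* d)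
  identity = solve-∀ ℚ-ring
NonNeg-*K {x@(a +√2· b)} {y@(c +√2· d)} (ir-dominant 0≤b 0≤-M) (ir-dominant 0≤d 0≤-N) =
  re-dominant (subst (0ℚ ≤_) (ℚP.+-comm (2ℚ ℚ.* b ℚ.* d) (a ℚ.* c))
                (+-nonNeg-dominated (2ℚ ℚ.* b ℚ.* d) (a ℚ.* c) (*-nonNeg (*-nonNeg 2ℚ-nonNeg 0≤b) 0≤d)
                  (subst (0ℚ ≤_) (identity a b c d)
                    (+-nonNeg (+-nonNeg (*-nonNeg 0≤-M 0≤-N) (*-nonNeg 0≤-M (square-nonNeg c))) (*-nonNeg 0≤-N (square-nonNeg a))))))
              (subst (0ℚ ≤_) (trans (neg-product (norm x) (norm y)) (sym (norm-*K x y))) (*-nonNeg 0≤-M 0≤-N))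
  where
  identity : ∀ a b c d →
    ℚ.- (a ℚ.* a ℚ.- 2ℚ ℚ.* b ℚ.* b) ℚ.* ℚ.- (c ℚ.* c ℚ.- 2ℚ ℚ.* d ℚ.* d)
      ℚ.+ ℚ.- (a ℚ.* a ℚ.- 2ℚ ℚ.* b ℚ.* b) ℚ.* (c ℚ.* c) ℚ.+ ℚ.- (c ℚ.* c ℚ.- 2ℚ ℚ.* d ℚ.* d) ℚ.* (a ℚ.* a)
    ≡ 2ℚ ℚ.* b ℚ.* d ℚ.* (2ℚ ℚ.* b ℚ.* d) ℚ.- a ℚ.* c ℚ.* (a ℚ.* c)
  identity = solve-∀ ℚ-ring
  neg-product : ∀ p q → ℚ.- p ℚ.* ℚ.- q ≡ p ℚ.* q
  neg-product = solve-∀ ℚ-ring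
NonNeg-*K {x@(a +√2· b)} {y@(c +√2· d)} (re-dominant 0≤a 0≤M) (ir-dominant 0≤d 0≤-N) =
  ir-dominant (+-nonNeg-dominated (a ℚ.* d) (b ℚ.* c) (*-nonNeg 0≤a 0≤d)
                 (subst (0ℚ ≤_) (identity a b c d) (+-nonNeg (*-nonNeg 0≤M (square-nonNeg d)) (*-nonNeg (square-nonNeg b) 0≤-N))))
              (subst (0ℚ ≤_) (trans (neg-right (norm x) (norm y)) (cong ℚ.-_ (sym (norm-*K x y)))) (*-nonNeg 0≤M 0≤-N))
  where
  identity : ∀ a b c d →
    (a ℚ.* a ℚ.- 2ℚ ℚ.* b ℚ.* b) ℚ.* (d ℚ.* d) ℚ.+ b ℚ.* b ℚ.* ℚ.- (c ℚ.* c ℚ.- 2ℚ ℚ.* d ℚ.* d)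
    ≡ a ℚ.* d ℚ.* (a ℚ.* d) ℚ.- b ℚ.* c ℚ.* (b ℚ.* c)
  identity = solve-∀ ℚ-ring
  neg-right : ∀ p q → p ℚ.* ℚ.- q ≡ ℚ.- (p ℚ.* q)
  neg-right = solve-∀ ℚ-ring
NonNeg-*K {x} {y} nx@(ir-dominant _ _) ny@(re-dominant _ _) = subst NonNeg (*K-comm y x) (NonNeg-*K ny nx)

NonNeg-+fromℚ : ∀ {x r} → NonNeg x → 0ℚ ≤ r → NonNeg (x +K fromℚ r)
NonNeg-+fromℚ {a +√2· b} {r} (re-dominant 0≤a 0≤N) 0≤r =
  re-dominant (+-nonNeg 0≤a 0≤r)
    (subst (0ℚ ≤_) (identity a b r) (+-nonNeg (+-nonNeg 0≤N (*-nonNeg (*-nonNeg 2ℚ-nonNeg 0≤a) 0≤r)) (square-nonNeg r)))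
  where
  identity : ∀ a b r →
    a ℚ.* a ℚ.- 2ℚ ℚ.* b ℚ.* b ℚ.+ 2ℚ ℚ.* a ℚ.* r ℚ.+ r ℚ.* r ≡
    (a ℚ.+ r) ℚ.* (a ℚ.+ r) ℚ.- 2ℚ ℚ.* (b ℚ.+ 0ℚ) ℚ.* (b ℚ.+ 0ℚ)
  identity = solve-∀ ℚ-ring
NonNeg-+fromℚ {x@(a +√2· b)} {r} (ir-dominant 0≤b 0≤-N) 0≤r with 0ℚ ℚP.≤? ℚ.- norm (x +K fromℚ r)
... | yes 0≤-N' = ir-dominant (subst (0ℚ ≤_) (sym (ℚP.+-identityʳ b)) 0≤b) 0≤-N'
... | no 0≰-N' = re-dominant 0≤a+r (subst (0ℚ ≤_) (neg-neg (norm (x +K fromℚ r))) (neg-nonNeg (ℚP.<⇒≤ (ℚP.≰⇒> 0≰-N'))))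
  where
  neg-neg : ∀ p → ℚ.- ℚ.- p ≡ p
  neg-neg = solve-∀ ℚ-ring
  identity : ∀ a b r →
    ℚ.- (a ℚ.* a ℚ.- 2ℚ ℚ.* b ℚ.* b) ℚ.+ r ℚ.* (ℚ.- (a ℚ.+ r) ℚ.+ ℚ.- (a ℚ.+ r) ℚ.+ r) ≡
    ℚ.- ((a ℚ.+ r) ℚ.* (a ℚ.+ r) ℚ.- 2ℚ ℚ.* (b ℚ.+ 0ℚ) ℚ.* (b ℚ.+ 0ℚ))
  identity = solve-∀ ℚ-ring
  0≤a+r : 0ℚ ≤ a ℚ.+ r
  0≤a+r with 0ℚ ℚP.≤? a ℚ.+ r
  ... | yes 0≤a+r = 0≤a+r
  ... | no 0≰a+r = contradiction
    (subst (0ℚ ≤_) (identity a b r) (+-nonNeg 0≤-N (*-nonNeg 0≤r (+-nonNeg (+-nonNeg 0≤-[a+r] 0≤-[a+r]) 0≤r)))) 0≰-N'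
    where
    0≤-[a+r] : 0ℚ ≤ ℚ.- (a ℚ.+ r)
    0≤-[a+r] = neg-nonNeg (ℚP.<⇒≤ (ℚP.≰⇒> 0≰a+r))

norm-scale : ∀ r x → norm (fromℚ r *K x) ≡ r ℚ.* r ℚ.* norm x
norm-scale r x = trans (norm-*K (fromℚ r) x) (cong (ℚ._* norm x) (ℚP.+-identityʳ (r ℚ.* r)))

NonNeg-cancel-fromℚ : ∀ {r x} → 0ℚ < r → NonNeg (fromℚ r *K x) → NonNeg x
NonNeg-cancel-fromℚ {r} {x@(a +√2· b)} 0<r (re-dominant 0≤ra 0≤N) =
  re-dominant (*-nonNeg-cancelˡ 0<r (subst (0ℚ ≤_) (scale-re r a b) 0≤ra))
              (*-nonNeg-cancelˡ (square-pos 0<r) (subst (0ℚ ≤_) (norm-scale r x) 0≤N))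
  where
  scale-re : ∀ r a b → r ℚ.* a ℚ.+ 2ℚ ℚ.* 0ℚ ℚ.* b ≡ r ℚ.* a
  scale-re = solve-∀ ℚ-ring
NonNeg-cancel-fromℚ {r} {x@(a +√2· b)} 0<r (ir-dominant 0≤rb 0≤-N) =
  ir-dominant (*-nonNeg-cancelˡ 0<r (subst (0ℚ ≤_) (scale-ir r a b) 0≤rb))
              (*-nonNeg-cancelˡ (square-pos 0<r) (subst (0ℚ ≤_) (trans (cong ℚ.-_ (norm-scale r x)) (neg-right (r ℚ.* r) (norm x))) 0≤-N))
  where
  scale-ir : ∀ r a b → r ℚ.* b ℚ.+ 0ℚ ℚ.* a ≡ r ℚ.* b
  scale-ir = solve-∀ ℚ-ring
  neg-right : ∀ p q → ℚ.- (p ℚ.* q) ≡ p ℚ.* ℚ.- q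
  neg-right = solve-∀ ℚ-ring

-- The cofactor is conj x, negated when b√2 dominates.
rational-cofactor : ∀ {x} → NonNeg x → x ≡ 0K ⊎ ∃₂ λ y r → NonNeg y × 0ℚ < r × x *K y ≡ fromℚ r
rational-cofactor {x@(a +√2· b)} (re-dominant 0≤a 0≤N) with norm x ℚP.≟ 0ℚ
... | yes N≡0 = inj₁ (norm≡0⇒≡0K x N≡0)
... | no N≢0 = inj₂ (conj x , norm x , re-dominant 0≤a (subst (0ℚ ≤_) (norm-conj a b) 0≤N) , nonNeg∧≢0⇒pos 0≤N N≢0 , *K-conj x)
  where
  norm-conj : ∀ a b → a ℚ.* a ℚ.- 2ℚ ℚ.* b ℚ.* b ≡ a ℚ.* a ℚ.- 2ℚ ℚ.* ℚ.- b ℚ.* ℚ.- b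
  norm-conj = solve-∀ ℚ-ring
rational-cofactor {x@(a +√2· b)} (ir-dominant 0≤b 0≤-N) with ℚ.- norm x ℚP.≟ 0ℚ
... | yes -N≡0 = inj₁ (norm≡0⇒≡0K x (ℚP.neg-injective -N≡0))
... | no -N≢0 = inj₂ ((ℚ.- a +√2· b) , ℚ.- norm x , ir-dominant 0≤b (subst (0ℚ ≤_) (norm-neg-re a b) 0≤-N) ,
                      nonNeg∧≢0⇒pos 0≤-N -N≢0 , cong₂ _+√2·_ (re-part a b) (ir-part a b))
  where
  norm-neg-re : ∀ a b → ℚ.- (a ℚ.* a ℚ.- 2ℚ ℚ.* b ℚ.* b) ≡ ℚ.- (ℚ.- a ℚ.* ℚ.- a ℚ.- 2ℚ ℚ.* b ℚ.* b)
  norm-neg-re = solve-∀ ℚ-ring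
  re-part : ∀ a b → a ℚ.* ℚ.- a ℚ.+ 2ℚ ℚ.* b ℚ.* b ≡ ℚ.- (a ℚ.* a ℚ.- 2ℚ ℚ.* b ℚ.* b)
  re-part = solve-∀ ℚ-ring
  ir-part : ∀ a b → a ℚ.* b ℚ.+ b ℚ.* ℚ.- a ≡ 0ℚ
  ir-part = solve-∀ ℚ-ring

-- With x x' = r > 0, the identity r (x + y) = x (y x' + r) exhibits r (x + y) as nonnegative.
NonNeg-+K : ∀ {x y} → NonNeg x → NonNeg y → NonNeg (x +K y)
NonNeg-+K {x} {y} nx ny with rational-cofactor nx
... | inj₁ refl = subst NonNeg (sym (+K-identityˡ y)) ny
... | inj₂ (x' , r , nx' , 0<r , xx'≡r) =
  NonNeg-cancel-fromℚ 0<r (subst NonNeg factor (NonNeg-*K nx (NonNeg-+fromℚ (NonNeg-*K ny nx') (ℚP.<⇒≤ 0<r))))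
  where
  expand : ∀ x y x' R → x *K (y *K x' +K R) ≡ (x *K x') *K y +K R *K x
  expand = solve-∀ K-ring
  collect : ∀ x y R → R *K y +K R *K x ≡ R *K (x +K y)
  collect = solve-∀ K-ring
  factor : x *K (y *K x' +K fromℚ r) ≡ fromℚ r *K (x +K y)
  factor = begin
    x *K (y *K x' +K fromℚ r)               ≡⟨ expand x y x' (fromℚ r) ⟩
    (x *K x') *K y +K fromℚ r *K x          ≡⟨ cong (λ t → t *K y +K fromℚ r *K x) xx'≡r ⟩
    fromℚ r *K y +K fromℚ r *K x            ≡⟨ collect x y (fromℚ r) ⟩
    fromℚ r *K (x +K y)                     ∎
    where open ≡-Reasoning

private
  norm-neg : ∀ a b → ℚ.- a ℚ.* ℚ.- a ℚ.- 2ℚ ℚ.* ℚ.- b ℚ.* ℚ.- b ≡ a ℚ.* a ℚ.- 2ℚ ℚ.* b ℚ.* b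
  norm-neg = solve-∀ ℚ-ring

  double-square-nonNeg : ∀ b → 0ℚ ≤ 2ℚ ℚ.* b ℚ.* b
  double-square-nonNeg b = subst (0ℚ ≤_) (sym (ℚP.*-assoc 2ℚ b b)) (*-nonNeg 2ℚ-nonNeg (square-nonNeg b))

  norm-bounds : ∀ {x} → NonNeg x → NonNeg (-K x) → 0ℚ ≤ norm x × 0ℚ ≤ ℚ.- norm x
  norm-bounds {a +√2· b} (re-dominant 0≤a 0≤N) (re-dominant 0≤-a _) =
    0≤N , subst (λ a → 0ℚ ≤ ℚ.- (a ℚ.* a ℚ.- 2ℚ ℚ.* b ℚ.* b)) (sym (nonNeg-antisym 0≤a 0≤-a))
            (subst (0ℚ ≤_) (sym (re-zero b)) (double-square-nonNeg b))
    where
    re-zero : ∀ b → ℚ.- (0ℚ ℚ.* 0ℚ ℚ.- 2ℚ ℚ.* b ℚ.* b) ≡ 2ℚ ℚ.* b ℚ.* b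
    re-zero = solve-∀ ℚ-ring
  norm-bounds {a +√2· b} (re-dominant _ 0≤N) (ir-dominant _ 0≤-N) = 0≤N , subst (λ t → 0ℚ ≤ ℚ.- t) (norm-neg a b) 0≤-N
  norm-bounds {a +√2· b} (ir-dominant _ 0≤-N) (re-dominant _ 0≤N) = subst (0ℚ ≤_) (norm-neg a b) 0≤N , 0≤-N
  norm-bounds {a +√2· b} (ir-dominant 0≤b 0≤-N) (ir-dominant 0≤-b _) =
    subst (λ b → 0ℚ ≤ a ℚ.* a ℚ.- 2ℚ ℚ.* b ℚ.* b) (sym (nonNeg-antisym 0≤b 0≤-b))
      (subst (0ℚ ≤_) (ir-zero a) (square-nonNeg a)) , 0≤-N
    where
    ir-zero : ∀ a → a ℚ.* a ≡ a ℚ.* a ℚ.- 2ℚ ℚ.* 0ℚ ℚ.* 0ℚ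
    ir-zero = solve-∀ ℚ-ring

NonNeg-antisym : ∀ {x} → NonNeg x → NonNeg (-K x) → x ≡ 0K
NonNeg-antisym {x} nx n-x = norm≡0⇒≡0K x (nonNeg-antisym (proj₁ bounds) (proj₂ bounds))
  where bounds = norm-bounds nx n-x

NonNeg-fromℚ : ∀ {q} → 0ℚ ≤ q → NonNeg (fromℚ q)
NonNeg-fromℚ {q} 0≤q = re-dominant 0≤q (subst (0ℚ ≤_) (sym (ℚP.+-identityʳ (q ℚ.* q))) (square-nonNeg q))

NonNeg-1K : NonNeg 1K
NonNeg-1K = NonNeg-fromℚ (ℚP.nonNegative⁻¹ 1ℚ)

NonNeg-fromℚ⁻¹ : ∀ {q} → NonNeg (fromℚ q) → 0ℚ ≤ q
NonNeg-fromℚ⁻¹ (re-dominant 0≤q _) = 0≤q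
NonNeg-fromℚ⁻¹ {q} (ir-dominant _ 0≤-N) = ℚP.≤-reflexive (sym (square≡0⇒≡0 q
  (nonNeg-antisym (square-nonNeg q) (subst (λ t → 0ℚ ≤ ℚ.- t) (ℚP.+-identityʳ (q ℚ.* q)) 0≤-N))))

NonNeg-√2 : NonNeg √2
NonNeg-√2 = ir-dominant (ℚP.≤ᵇ⇒≤ tt) (ℚP.≤ᵇ⇒≤ tt)

-- Sums and matrices over ℚ(√2)

open import Algebra.Properties.Semiring.Sum (CommutativeRing.semiring K-commutativeRing) using (sum; ∑-comm; *-distribˡ-sum; *-distribʳ-sum; sum-cong-≗; sum-replicate-zero; sum-remove)

sum-zero : ∀ {n} (f : Fin n → K) → (∀ m → f m ≡ 0K) → sum f ≡ 0K
sum-zero {n} f f≡0 = trans (sum-cong-≗ f≡0) (sum-replicate-zero n)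

sum-single : ∀ {n} (f : Fin n → K) p → (∀ m → m ≢ p → f m ≡ 0K) → sum f ≡ f p
sum-single {suc n} f p off-p = begin
  sum f                                       ≡⟨ sum-remove {i = p} f ⟩
  f p +K sum (λ m → f (punchIn p m))          ≡⟨ cong (f p +K_) (sum-zero _ (λ m → off-p _ (FinP.punchInᵢ≢i p m))) ⟩
  f p +K 0K                                   ≡⟨ +K-identityʳ (f p) ⟩
  f p                                         ∎
  where open ≡-Reasoning

sum≢0⇒∃≢0 : ∀ {n} (f : Fin n → K) → sum f ≢ 0K → ∃ λ k → f k ≢ 0K
sum≢0⇒∃≢0 {n} f sum≢0 = FinP.¬∀⟶∃¬ n (λ k → f k ≡ 0K) (λ k → f k ≟K 0K) (sum≢0 ∘ sum-zero f)

NonNeg-0K : NonNeg 0K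
NonNeg-0K = re-dominant ℚP.≤-refl ℚP.≤-refl

NonNeg-sum : ∀ {n} {f : Fin n → K} → (∀ k → NonNeg (f k)) → NonNeg (sum f)
NonNeg-sum {zero} nf = NonNeg-0K
NonNeg-sum {suc n} nf = NonNeg-+K (nf zero) (NonNeg-sum (nf ∘ suc))

NonNeg-+K≡0 : ∀ {x y} → NonNeg x → NonNeg y → x +K y ≡ 0K → x ≡ 0K × y ≡ 0K
NonNeg-+K≡0 {x} {y} nx ny x+y≡0 = x≡0 , trans y≡-x (cong -K_ x≡0)
  where
  cancel : ∀ x y → y ≡ -K x +K (x +K y)
  cancel = solve-∀ K-ring
  y≡-x : y ≡ -K x
  y≡-x = trans (cancel x y) (trans (cong (-K x +K_) x+y≡0) (+K-identityʳ (-K x)))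
  x≡0 : x ≡ 0K
  x≡0 = NonNeg-antisym nx (subst NonNeg y≡-x ny)

NonNeg-sum≡0 : ∀ {n} {f : Fin n → K} → (∀ k → NonNeg (f k)) → sum f ≡ 0K → ∀ k → f k ≡ 0K
NonNeg-sum≡0 {suc n} nf Σ≡0 zero = proj₁ (NonNeg-+K≡0 (nf zero) (NonNeg-sum (nf ∘ suc)) Σ≡0)
NonNeg-sum≡0 {suc n} nf Σ≡0 (suc k) = NonNeg-sum≡0 (nf ∘ suc) (proj₂ (NonNeg-+K≡0 (nf zero) (NonNeg-sum (nf ∘ suc)) Σ≡0)) k

KMatrix : ℕ → Set
KMatrix n = Fin n → Fin n → K

infixr 7 _*ᵛ_
infixl 7 _*ᴹ_

_*ᵛ_ : ∀ {n} → KMatrix n → (Fin n → K) → Fin n → K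
(A *ᵛ x) i = sum λ k → A i k *K x k

_*ᴹ_ : ∀ {n} → KMatrix n → KMatrix n → KMatrix n
(A *ᴹ B) i j = sum λ k → A i k *K B k j

1ᴹ : ∀ {n} → KMatrix n
1ᴹ i j = ℤtoK (δ i j)

δ-diag : ∀ {n} (i : Fin n) → δ i i ≡ ℤ.+ 1
δ-diag zero = refl
δ-diag (suc i) = δ-diag i

δ-off : ∀ {n} {i j : Fin n} → i ≢ j → δ i j ≡ ℤ.+ 0
δ-off {i = zero} {zero} i≢j = contradiction refl i≢j
δ-off {i = zero} {suc j} _ = refl
δ-off {i = suc i} {zero} _ = refl
δ-off {i = suc i} {suc j} i≢j = δ-off (i≢j ∘ cong suc)

1ᴹ-*ᵛ : ∀ {n} (x : Fin n → K) i → (1ᴹ *ᵛ x) i ≡ x i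
1ᴹ-*ᵛ x i = begin
  (1ᴹ *ᵛ x) i             ≡⟨ sum-single _ i (λ m m≢i → trans (cong (λ d → ℤtoK d *K x m) (δ-off (m≢i ∘ sym))) (*K-zeroˡ (x m))) ⟩
  ℤtoK (δ i i) *K x i     ≡⟨ cong (λ d → ℤtoK d *K x i) (δ-diag i) ⟩
  1K *K x i               ≡⟨ *K-identityˡ (x i) ⟩
  x i                     ∎
  where open ≡-Reasoning

*ᵛ-congʳ : ∀ {n} (A : KMatrix n) {x y : Fin n → K} → (∀ k → x k ≡ y k) → ∀ i → (A *ᵛ x) i ≡ (A *ᵛ y) i
*ᵛ-congʳ A x≗y i = sum-cong-≗ λ k → cong (A i k *K_) (x≗y k)

*ᵛ-congˡ : ∀ {n} {A B : KMatrix n} → (∀ i k → A i k ≡ B i k) → ∀ x i → (A *ᵛ x) i ≡ (B *ᵛ x) i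
*ᵛ-congˡ A≈B x i = sum-cong-≗ λ k → cong (_*K x k) (A≈B i k)

*ᵛ-assoc : ∀ {n} (A B : KMatrix n) x i → (A *ᵛ B *ᵛ x) i ≡ ((A *ᴹ B) *ᵛ x) i
*ᵛ-assoc A B x i = begin
  sum (λ k → A i k *K sum (λ m → B k m *K x m))    ≡⟨ sum-cong-≗ (λ k → *-distribˡ-sum (A i k) (λ m → B k m *K x m)) ⟩
  sum (λ k → sum (λ m → A i k *K (B k m *K x m)))  ≡⟨ ∑-comm (λ k m → A i k *K (B k m *K x m)) ⟩
  sum (λ m → sum (λ k → A i k *K (B k m *K x m)))  ≡⟨ sum-cong-≗ (λ m → sum-cong-≗ (λ k → sym (*K-assoc (A i k) (B k m) (x m)))) ⟩
  sum (λ m → sum (λ k → A i k *K B k m *K x m))    ≡⟨ sum-cong-≗ (λ m → sym (*-distribʳ-sum (x m) (λ k → A i k *K B k m))) ⟩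
  sum (λ m → (A *ᴹ B) i m *K x m)                  ∎
  where open ≡-Reasoning

conj-sum : ∀ {n} (f : Fin n → K) → conj (sum f) ≡ sum (conj ∘ f)
conj-sum {zero} f = refl
conj-sum {suc n} f = trans (conj-+K (f zero) (sum (f ∘ suc))) (cong (conj (f zero) +K_) (conj-sum (f ∘ suc)))

conjᴹ : ∀ {n} → KMatrix n → KMatrix n
conjᴹ A i j = conj (A i j)

conj-*ᵛ : ∀ {n} (A : KMatrix n) x i → conj ((A *ᵛ x) i) ≡ (conjᴹ A *ᵛ conj ∘ x) i
conj-*ᵛ A x i = trans (conj-sum (λ k → A i k *K x k)) (sum-cong-≗ λ k → conj-*K (A i k) (x k))

*ᵛ-1ᴹ-column : ∀ {n} (A : KMatrix n) k j → (A *ᵛ (λ m → 1ᴹ m k)) j ≡ A j k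
*ᵛ-1ᴹ-column A k j = begin
  (A *ᵛ (λ m → 1ᴹ m k)) j    ≡⟨ sum-single _ k (λ m m≢k → trans (cong (λ d → A j m *K ℤtoK d) (δ-off m≢k)) (*K-zeroʳ (A j m))) ⟩
  A j k *K ℤtoK (δ k k)      ≡⟨ cong (λ d → A j k *K ℤtoK d) (δ-diag k) ⟩
  A j k *K 1K                ≡⟨ *K-identityʳ (A j k) ⟩
  A j k                      ∎
  where open ≡-Reasoning

NonNeg-1ᴹ : ∀ {n} (i j : Fin n) → NonNeg (1ᴹ i j)
NonNeg-1ᴹ i j with i FinP.≟ j
... | yes refl = subst (NonNeg ∘ ℤtoK) (sym (δ-diag i)) NonNeg-1K
... | no i≢j = subst (NonNeg ∘ ℤtoK) (sym (δ-off i≢j)) NonNeg-0K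

-- Monomial matrices

injective⇒surjective : ∀ {n} {f : Fin n → Fin n} → Injective _≡_ _≡_ f → ∀ m → ∃ λ j → f j ≡ m
injective⇒surjective {suc n} {f} f-injective m with FinP.any? (λ j → f j FinP.≟ m)
... | yes hit = hit
... | no miss = contradiction (λ {i} {j} → f-injective ∘ FinP.punchOut-injective (avoids i) (avoids j))
                             (FinP.<⇒notInjective (ℕP.n<1+n n))
  where
  avoids : ∀ j → m ≢ f j
  avoids j m≡fj = miss (j , sym m≡fj)

record Monomial {n} (A : KMatrix n) : Set where
  field
    κ        : Fin n → Fin n
    pivot≢0  : ∀ j → A j (κ j) ≢ 0K
    row-off  : ∀ j m → m ≢ κ j → A j m ≡ 0K
    col-off  : ∀ i j → i ≢ j → A i (κ j) ≡ 0K

  pivot : Fin n → K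
  pivot j = A j (κ j)

  *ᵛ-pivot : ∀ v j → (A *ᵛ v) j ≡ pivot j *K v (κ j)
  *ᵛ-pivot v j = sum-single _ (κ j) (λ m m≢κj → trans (cong (_*K v m) (row-off j m m≢κj)) (*K-zeroˡ (v m)))

  *ᵛ-conj-pivot-column : ∀ (B : KMatrix n) j l → (B *ᵛ (λ i → conj (A i (κ j)))) l ≡ B l j *K conj (pivot j)
  *ᵛ-conj-pivot-column B j l =
    sum-single _ j (λ i i≢j → trans (cong (λ a → B l i *K conj a) (col-off i j i≢j)) (*K-zeroʳ (B l i)))

-- Column j of the inverse meets row j of A in a nonzero product A j k μ k, and positivity
-- kills every other entry of column k; counting then makes j ↦ k a permutation.
nonNeg-inverse⇒monomial : ∀ {n} {A : KMatrix n} → (∀ l k → NonNeg (A l k)) →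
  (∀ j → ∃ λ μ → (∀ k → NonNeg (μ k)) × (∀ l → (A *ᵛ μ) l ≡ 1ᴹ l j)) → Monomial A
nonNeg-inverse⇒monomial {n} {A} A≥0 inverse = record
  { κ = κ ; pivot≢0 = proj₁ ∘ proj₂ ∘ pivot-column ; row-off = row-off ; col-off = col-off }
  where
  pivot-column : ∀ j → ∃ λ k → A j k ≢ 0K × (∀ l → l ≢ j → A l k ≡ 0K)
  pivot-column j with inverse j
  ... | μ , μ≥0 , Aμ≡eⱼ
      with sum≢0⇒∃≢0 (λ k → A j k *K μ k) (λ Σ≡0 → 1K≢0K (trans (sym (trans (Aμ≡eⱼ j) (cong ℤtoK (δ-diag j)))) Σ≡0))
  ... | k , Aμ≢0 = k , (λ A≡0 → Aμ≢0 (trans (cong (_*K μ k) A≡0) (*K-zeroˡ (μ k)))) , off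
    where
    μk≢0 : μ k ≢ 0K
    μk≢0 μ≡0 = Aμ≢0 (trans (cong (A j k *K_) μ≡0) (*K-zeroʳ (A j k)))
    off : ∀ l → l ≢ j → A l k ≡ 0K
    off l l≢j = x*y≡0⇒x≡0 (A l k) (μ k) μk≢0
      (NonNeg-sum≡0 (λ k → NonNeg-*K (A≥0 l k) (μ≥0 k)) (trans (Aμ≡eⱼ l) (cong ℤtoK (δ-off l≢j))) k)
  κ : Fin n → Fin n
  κ = proj₁ ∘ pivot-column
  col-off : ∀ i j → i ≢ j → A i (κ j) ≡ 0K
  col-off i j = proj₂ (proj₂ (pivot-column j)) i
  κ-injective : Injective _≡_ _≡_ κ
  κ-injective {i} {j} κi≡κj with i FinP.≟ j
  ... | yes i≡j = i≡j
  ... | no i≢j = contradiction (subst (λ c → A i c ≡ 0K) (sym κi≡κj) (col-off i j i≢j)) (proj₁ (proj₂ (pivot-column i)))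
  row-off : ∀ j m → m ≢ κ j → A j m ≡ 0K
  row-off j m m≢κj with injective⇒surjective κ-injective m
  ... | j' , refl = col-off j j' (λ { refl → m≢κj refl })

-- Coordinates with respect to the generators of C

¼ -¼ : ℚ
¼ = + 1 ℚ./ 4
-¼ = ℚ.- ¼

genMatrix : KMatrix 4
genMatrix i k = gen k i

-- genMatrix⁻¹; row j is the j-th coordinate functional of the basis gen.
dual : KMatrix 4
dual i j = Vec.lookup (Vec.lookup rows i) j
  where
  rows : Vec (Vec K 4) 4
  rows = (fromℚ ½    ∷ (0ℚ +√2· ¼)  ∷ fromℚ -½  ∷ (0ℚ +√2· -¼) ∷ [])
       ∷ (0K         ∷ 0K           ∷ fromℚ ½   ∷ (0ℚ +√2· ¼)  ∷ [])
       ∷ (fromℚ -½   ∷ (0ℚ +√2· ¼)  ∷ 0K        ∷ 0K           ∷ [])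
       ∷ (1K         ∷ (0ℚ +√2· -½) ∷ fromℚ -½  ∷ (0ℚ +√2· ¼)  ∷ [])
       ∷ []

-- conj (gen k) = Σₗ conjCoords l k · gen l
conjCoords : KMatrix 4
conjCoords l k = ℤtoK (Vec.lookup (Vec.lookup rows l) k)
  where
  rows : Vec (Vec ℤ 4) 4
  rows = (+ 0        ∷ + 0        ∷ + 1          ∷ + 1        ∷ [])
       ∷ (+ 0        ∷ + 0        ∷ ℤ.- (+ 2)    ∷ ℤ.- (+ 1)  ∷ [])
       ∷ (ℤ.- (+ 1)  ∷ ℤ.- (+ 1)  ∷ + 0          ∷ + 0        ∷ [])
       ∷ (+ 2        ∷ + 1        ∷ + 0          ∷ + 0        ∷ [])
       ∷ []

dual-genMatrix : ∀ i j → (dual *ᴹ genMatrix) i j ≡ 1ᴹ i j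
dual-genMatrix = toWitness {a? = FinP.all? λ i → FinP.all? λ j → (dual *ᴹ genMatrix) i j ≟K 1ᴹ i j} tt

genMatrix-dual : ∀ i j → (genMatrix *ᴹ dual) i j ≡ 1ᴹ i j
genMatrix-dual = toWitness {a? = FinP.all? λ i → FinP.all? λ j → (genMatrix *ᴹ dual) i j ≟K 1ᴹ i j} tt

dual-conj-genMatrix : ∀ l k → (dual *ᴹ conjᴹ genMatrix) l k ≡ conjCoords l k
dual-conj-genMatrix = toWitness {a? = FinP.all? λ l → FinP.all? λ k → (dual *ᴹ conjᴹ genMatrix) l k ≟K conjCoords l k} tt

coord : Vec4 K → Vec4 K
coord x = dual *ᵛ x

genMatrix-coord : ∀ x i → (genMatrix *ᵛ coord x) i ≡ x i
genMatrix-coord x i = begin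
  (genMatrix *ᵛ dual *ᵛ x) i       ≡⟨ *ᵛ-assoc genMatrix dual x i ⟩
  ((genMatrix *ᴹ dual) *ᵛ x) i     ≡⟨ *ᵛ-congˡ genMatrix-dual x i ⟩
  (1ᴹ *ᵛ x) i                      ≡⟨ 1ᴹ-*ᵛ x i ⟩
  x i                              ∎
  where open ≡-Reasoning

coord-genMatrix : ∀ w j → coord (genMatrix *ᵛ w) j ≡ w j
coord-genMatrix w j = begin
  (dual *ᵛ genMatrix *ᵛ w) j       ≡⟨ *ᵛ-assoc dual genMatrix w j ⟩
  ((dual *ᴹ genMatrix) *ᵛ w) j     ≡⟨ *ᵛ-congˡ dual-genMatrix w j ⟩
  (1ᴹ *ᵛ w) j                      ≡⟨ 1ᴹ-*ᵛ w j ⟩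
  w j                              ∎
  where open ≡-Reasoning

sum4K≡sum : ∀ f → sum4K f ≡ sum f
sum4K≡sum f = reassociate (f f0) (f f1) (f f2) (f f3)
  where
  reassociate : ∀ a b c d → a +K b +K c +K d ≡ a +K (b +K (c +K (d +K 0K)))
  reassociate = solve-∀ K-ring

sum4K-gen≡genMatrix-*ᵛ : ∀ w i → sum4K (λ j → w j *K gen j i) ≡ (genMatrix *ᵛ w) i
sum4K-gen≡genMatrix-*ᵛ w i = trans (sum4K≡sum (λ j → w j *K gen j i)) (sum-cong-≗ λ j → *K-comm (w j) (gen j i))

InC⇒coord-nonNeg : ∀ {x} → InC x → ∀ j → NonNeg (coord x j)
InC⇒coord-nonNeg {x} (λs , λs≥0 , x≡Σ) j = subst NonNeg (sym coord-x≡λs) (NonNegK⇒NonNeg (λs≥0 j))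
  where
  coord-x≡λs : coord x j ≡ λs j
  coord-x≡λs = trans (*ᵛ-congʳ dual (λ i → trans (x≡Σ i) (sum4K-gen≡genMatrix-*ᵛ λs i)) j) (coord-genMatrix λs j)

coord-nonNeg⇒InC : ∀ {x} → (∀ j → NonNeg (coord x j)) → InC x
coord-nonNeg⇒InC {x} coord≥0 =
  coord x , NonNeg⇒NonNegK ∘ coord≥0 , λ i → trans (sym (genMatrix-coord x i)) (sym (sum4K-gen≡genMatrix-*ᵛ (coord x) i))

InC-gen : ∀ k → InC (gen k)
InC-gen k = coord-nonNeg⇒InC λ j → subst NonNeg (sym (dual-genMatrix j k)) (NonNeg-1ᴹ j k)

-- Linear automorphisms of C

toKMatrix : Mat → KMatrix 4
toKMatrix T i k = ℤtoK (T i k)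

·K≡*ᵛ : ∀ T x i → (T ·K x) i ≡ (toKMatrix T *ᵛ x) i
·K≡*ᵛ T x i = sum4K≡sum (λ k → ℤtoK (T i k) *K x k)

conj-·K : ∀ T x i → conj ((T ·K x) i) ≡ (T ·K (conj ∘ x)) i
conj-·K T x i = begin
  conj ((T ·K x) i)                   ≡⟨ cong conj (·K≡*ᵛ T x i) ⟩
  conj ((toKMatrix T *ᵛ x) i)         ≡⟨ conj-*ᵛ (toKMatrix T) x i ⟩
  (toKMatrix T *ᵛ conj ∘ x) i         ≡⟨ ·K≡*ᵛ T (conj ∘ x) i ⟨
  (T ·K (conj ∘ x)) i                 ∎
  where open ≡-Reasoning

inGenBasis : Mat → KMatrix 4
inGenBasis T = dual *ᴹ (toKMatrix T *ᴹ genMatrix)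

coord-·K : ∀ T x l → coord (T ·K x) l ≡ (inGenBasis T *ᵛ coord x) l
coord-·K T x l = begin
  (dual *ᵛ (T ·K x)) l                                   ≡⟨ *ᵛ-congʳ dual (·K≡*ᵛ T x) l ⟩
  (dual *ᵛ toKMatrix T *ᵛ x) l                           ≡⟨ *ᵛ-congʳ dual (*ᵛ-congʳ (toKMatrix T) (sym ∘ genMatrix-coord x)) l ⟩
  (dual *ᵛ toKMatrix T *ᵛ genMatrix *ᵛ coord x) l        ≡⟨ *ᵛ-congʳ dual (*ᵛ-assoc (toKMatrix T) genMatrix (coord x)) l ⟩
  (dual *ᵛ (toKMatrix T *ᴹ genMatrix) *ᵛ coord x) l      ≡⟨ *ᵛ-assoc dual (toKMatrix T *ᴹ genMatrix) (coord x) l ⟩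
  (inGenBasis T *ᵛ coord x) l                            ∎
  where open ≡-Reasoning

coord-·K-gen : ∀ T k l → coord (T ·K gen k) l ≡ inGenBasis T l k
coord-·K-gen T k l = begin
  coord (T ·K gen k) l                           ≡⟨ coord-·K T (gen k) l ⟩
  (inGenBasis T *ᵛ coord (gen k)) l              ≡⟨ *ᵛ-congʳ (inGenBasis T) (λ m → dual-genMatrix m k) l ⟩
  (inGenBasis T *ᵛ (λ m → 1ᴹ m k)) l             ≡⟨ *ᵛ-1ᴹ-column (inGenBasis T) k l ⟩
  inGenBasis T l k                               ∎
  where open ≡-Reasoning

coord-conj : ∀ y l → coord (conj ∘ y) l ≡ (conjCoords *ᵛ conj ∘ coord y) l
coord-conj y l = begin
  (dual *ᵛ conj ∘ y) l                                  ≡⟨ *ᵛ-congʳ dual (λ i → cong conj (sym (genMatrix-coord y i))) l ⟩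
  (dual *ᵛ conj ∘ (genMatrix *ᵛ coord y)) l             ≡⟨ *ᵛ-congʳ dual (conj-*ᵛ genMatrix (coord y)) l ⟩
  (dual *ᵛ conjᴹ genMatrix *ᵛ conj ∘ coord y) l         ≡⟨ *ᵛ-assoc dual (conjᴹ genMatrix) (conj ∘ coord y) l ⟩
  ((dual *ᴹ conjᴹ genMatrix) *ᵛ conj ∘ coord y) l       ≡⟨ *ᵛ-congˡ dual-conj-genMatrix (conj ∘ coord y) l ⟩
  (conjCoords *ᵛ conj ∘ coord y) l                      ∎
  where open ≡-Reasoning

-- T is rational, so it commutes with conj; in the basis gen this reads
-- M · conjCoords = conjCoords · conj M.
inGenBasis-conj : ∀ T k l →
  (inGenBasis T *ᵛ (λ m → conjCoords m k)) l ≡ (conjCoords *ᵛ (λ j → conj (inGenBasis T j k))) l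
inGenBasis-conj T k l = begin
  (inGenBasis T *ᵛ (λ m → conjCoords m k)) l         ≡⟨ *ᵛ-congʳ (inGenBasis T) (λ m → dual-conj-genMatrix m k) l ⟨
  (inGenBasis T *ᵛ coord (conj ∘ gen k)) l           ≡⟨ coord-·K T (conj ∘ gen k) l ⟨
  coord (T ·K (conj ∘ gen k)) l                      ≡⟨ *ᵛ-congʳ dual (λ i → conj-·K T (gen k) i) l ⟨
  coord (conj ∘ (T ·K gen k)) l                      ≡⟨ coord-conj (T ·K gen k) l ⟩
  (conjCoords *ᵛ conj ∘ coord (T ·K gen k)) l        ≡⟨ *ᵛ-congʳ conjCoords (λ j → cong conj (coord-·K-gen T k j)) l ⟩
  (conjCoords *ᵛ (λ j → conj (inGenBasis T j k))) l  ∎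
  where open ≡-Reasoning

ℤtoK-sum4ℤ : ∀ f → ℤtoK (sum4ℤ f) ≡ sum4K (ℤtoK ∘ f)
ℤtoK-sum4ℤ f =
  trans (ℤtoK-+ (f f0 ℤ.+ f f1 ℤ.+ f f2) (f f3)) (cong (_+K ℤtoK (f f3))
    (trans (ℤtoK-+ (f f0 ℤ.+ f f1) (f f2)) (cong (_+K ℤtoK (f f2)) (ℤtoK-+ (f f0) (f f1)))))

embed-·ℤ : ∀ T r i → embed (T ·ℤ r) i ≡ (T ·K embed r) i
embed-·ℤ T r i = begin
  ℤtoK (sum4ℤ λ k → T i k ℤ.* r k)        ≡⟨ ℤtoK-sum4ℤ (λ k → T i k ℤ.* r k) ⟩
  sum4K (λ k → ℤtoK (T i k ℤ.* r k))      ≡⟨ sum4K≡sum (λ k → ℤtoK (T i k ℤ.* r k)) ⟩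
  sum (λ k → ℤtoK (T i k ℤ.* r k))        ≡⟨ sum-cong-≗ (λ k → ℤtoK-* (T i k) (r k)) ⟩
  sum (λ k → ℤtoK (T i k) *K ℤtoK (r k))  ≡⟨ sum4K≡sum (λ k → ℤtoK (T i k) *K ℤtoK (r k)) ⟨
  (T ·K embed r) i                        ∎
  where open ≡-Reasoning

inGenBasis-nonNeg : ∀ T → (∀ x → InC x → InC (T ·K x)) → ∀ l k → NonNeg (inGenBasis T l k)
inGenBasis-nonNeg T T[C]⊆C l k = subst NonNeg (coord-·K-gen T k l) (InC⇒coord-nonNeg {T ·K gen k} (T[C]⊆C (gen k) (InC-gen k)) l)

inGenBasis-inverse : ∀ T → (∀ y → InC y → Σ (Vec4 K) λ x → InC x × (∀ i → (T ·K x) i ≡ y i)) →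
  ∀ j → ∃ λ μ → (∀ k → NonNeg (μ k)) × (∀ l → (inGenBasis T *ᵛ μ) l ≡ 1ᴹ l j)
inGenBasis-inverse T C⊆T[C] j = coord x , InC⇒coord-nonNeg {x} x∈C , λ l → begin
  (inGenBasis T *ᵛ coord x) l     ≡⟨ coord-·K T x l ⟨
  coord (T ·K x) l                ≡⟨ *ᵛ-congʳ dual Tx≡gⱼ l ⟩
  coord (gen j) l                 ≡⟨ dual-genMatrix l j ⟩
  1ᴹ l j                          ∎
  where
  open ≡-Reasoning
  preimage = C⊆T[C] (gen j) (InC-gen j)
  x : Vec4 K
  x = proj₁ preimage
  x∈C : InC x
  x∈C = proj₁ (proj₂ preimage)
  Tx≡gⱼ : ∀ i → (T ·K x) i ≡ gen j i
  Tx≡gⱼ = proj₂ (proj₂ preimage)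

-- What survives of a monomial M with M · conjCoords = conjCoords · conj M on the first two
-- coordinates: the pivot columns κ₀, κ₁ and, through the column κ₂ = κ 2, the ratio d₀ : d₁.
record Signature (M : KMatrix 4) (κ₀ κ₁ κ₂ : Fin 4) : Set where
  field
    d₀ d₁ c  : K
    row₀     : ∀ v → (M *ᵛ v) f0 ≡ d₀ *K v κ₀
    row₁     : ∀ v → (M *ᵛ v) f1 ≡ d₁ *K v κ₁
    galois₀  : conjCoords κ₀ κ₂ *K d₀ ≡ conjCoords f0 f2 *K c
    galois₁  : conjCoords κ₁ κ₂ *K d₁ ≡ conjCoords f1 f2 *K c
    c≢0      : c ≢ 0K

monomial-signature : ∀ {M} (mono : Monomial M) →
  (∀ k l → (M *ᵛ (λ m → conjCoords m k)) l ≡ (conjCoords *ᵛ (λ j → conj (M j k))) l) →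
  let open Monomial mono in Signature M (κ f0) (κ f1) (κ f2)
monomial-signature {M} mono M-conj = record
  { d₀ = pivot f0 ; d₁ = pivot f1 ; c = conj (pivot f2)
  ; row₀ = λ v → *ᵛ-pivot v f0
  ; row₁ = λ v → *ᵛ-pivot v f1
  ; galois₀ = galois f0
  ; galois₁ = galois f1
  ; c≢0 = pivot≢0 f2 ∘ conj≡0K⇒≡0K (pivot f2)
  }
  where
  open Monomial mono
  galois : ∀ l → conjCoords (κ l) (κ f2) *K pivot l ≡ conjCoords l f2 *K conj (pivot f2)
  galois l = begin
    conjCoords (κ l) (κ f2) *K pivot l                          ≡⟨ *K-comm _ (pivot l) ⟩
    pivot l *K conjCoords (κ l) (κ f2)                          ≡⟨ *ᵛ-pivot (λ m → conjCoords m (κ f2)) l ⟨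
    (M *ᵛ (λ m → conjCoords m (κ f2))) l                        ≡⟨ M-conj (κ f2) l ⟩
    (conjCoords *ᵛ (λ j → conj (M j (κ f2)))) l                 ≡⟨ *ᵛ-conj-pivot-column conjCoords f2 l ⟩
    conjCoords l f2 *K conj (pivot f2)                          ∎
    where open ≡-Reasoning

-- The galois fields determine d₀ : d₁ from κ₀, κ₁ and κ₂ alone.
signature-proportional : ∀ {M M' κ₀ κ₁ κ₂} → Signature M κ₀ κ₁ κ₂ → Signature M' κ₀ κ₁ κ₂ →
  ∀ v → (M *ᵛ v) f0 *K (M' *ᵛ v) f1 ≡ (M' *ᵛ v) f0 *K (M *ᵛ v) f1
signature-proportional {M} {M'} {κ₀} {κ₁} {κ₂} σ σ' v = begin
  (M *ᵛ v) f0 *K (M' *ᵛ v) f1      ≡⟨ cong₂ _*K_ (row₀ σ v) (row₁ σ' v) ⟩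
  d₀ σ *K v κ₀ *K (d₁ σ' *K v κ₁)  ≡⟨ regroup (d₀ σ) (d₁ σ') (v κ₀) (v κ₁) ⟩
  d₀ σ *K d₁ σ' *K (v κ₀ *K v κ₁)  ≡⟨ cong (_*K (v κ₀ *K v κ₁)) pivot-ratio ⟩
  d₀ σ' *K d₁ σ *K (v κ₀ *K v κ₁)  ≡⟨ regroup (d₀ σ') (d₁ σ) (v κ₀) (v κ₁) ⟨
  d₀ σ' *K v κ₀ *K (d₁ σ *K v κ₁)  ≡⟨ cong₂ _*K_ (row₀ σ' v) (row₁ σ v) ⟨
  (M' *ᵛ v) f0 *K (M *ᵛ v) f1      ∎
  where
  open Signature
  open ≡-Reasoning
  p q a b : K
  p = conjCoords κ₀ κ₂
  q = conjCoords κ₁ κ₂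
  a = conjCoords f0 f2
  b = conjCoords f1 f2
  regroup : ∀ d e x y → d *K x *K (e *K y) ≡ d *K e *K (x *K y)
  regroup = solve-∀ K-ring
  interchange : ∀ p q d e → p *K q *K (d *K e) ≡ (p *K d) *K (q *K e)
  interchange = solve-∀ K-ring
  swap : ∀ a b c c' → (a *K c) *K (b *K c') ≡ (a *K c') *K (b *K c)
  swap = solve-∀ K-ring
  p≢0 : p ≢ 0K
  p≢0 p≡0 = *K-≢0 {a} {c σ} (λ ()) (c≢0 σ) (trans (sym (galois₀ σ)) (trans (cong (_*K d₀ σ) p≡0) (*K-zeroˡ (d₀ σ))))
  q≢0 : q ≢ 0K
  q≢0 q≡0 = *K-≢0 {b} {c σ} (λ ()) (c≢0 σ) (trans (sym (galois₁ σ)) (trans (cong (_*K d₁ σ) q≡0) (*K-zeroˡ (d₁ σ))))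
  pivot-ratio : d₀ σ *K d₁ σ' ≡ d₀ σ' *K d₁ σ
  pivot-ratio = *K-cancelˡ (p *K q) (*K-≢0 p≢0 q≢0) (begin
    p *K q *K (d₀ σ *K d₁ σ')          ≡⟨ interchange p q (d₀ σ) (d₁ σ') ⟩
    (p *K d₀ σ) *K (q *K d₁ σ')        ≡⟨ cong₂ _*K_ (galois₀ σ) (galois₁ σ') ⟩
    (a *K c σ) *K (b *K c σ')          ≡⟨ swap a b (c σ) (c σ') ⟩
    (a *K c σ') *K (b *K c σ)          ≡⟨ cong₂ _*K_ (galois₀ σ') (galois₁ σ) ⟨
    (p *K d₀ σ') *K (q *K d₁ σ)        ≡⟨ interchange p q (d₀ σ') (d₁ σ) ⟨
    p *K q *K (d₀ σ' *K d₁ σ)          ∎)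
-- Lattice points of C

module _ {t : Vec4 ℤ} (t∈S : InS t) where
  private
    c : Vec4 K
    c = coord (embed t)
    c≥0 : ∀ j → NonNeg (c j)
    c≥0 = InC⇒coord-nonNeg t∈S
    t≡Gc : ∀ i → ℤtoK (t i) ≡ (genMatrix *ᵛ c) i
    t≡Gc i = sym (genMatrix-coord (embed t) i)

  -- Every generator but gen 3 has second coordinate √2, and gen 3 spans a ray without rational points.
  height-expansion : ℤtoK (t f1) ≡ √2 *K (c f0 +K c f1 +K c f2)
  height-expansion = trans (t≡Gc f1) (expand (c f0) (c f1) (c f2) (c f3))
    where
    expand : ∀ a b c d → gen f0 f1 *K a +K (gen f1 f1 *K b +K (gen f2 f1 *K c +K (gen f3 f1 *K d +K 0K))) ≡ √2 *K (a +K b +K c)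
    expand = solve-∀ K-ring

  S-height-nonNeg : + 0 ℤ.≤ t f1
  S-height-nonNeg = fromℤ-nonNeg⁻¹ (NonNeg-fromℚ⁻¹ (subst NonNeg (sym height-expansion)
    (NonNeg-*K NonNeg-√2 (NonNeg-+K (NonNeg-+K (c≥0 f0) (c≥0 f1)) (c≥0 f2)))))

  S-height-zero : t f1 ≡ + 0 → ∀ i → t i ≡ + 0
  S-height-zero t₁≡0 i = fromℤ-injective (cong re (trans (t≡Gc i) (sum-zero _ λ k → trans (cong (genMatrix i k *K_) (c≡0 k)) (*K-zeroʳ (genMatrix i k)))))
    where
    √2≢0 : √2 ≢ 0K
    √2≢0 ()
    c₀+c₁+c₂≡0 : c f0 +K c f1 +K c f2 ≡ 0K
    c₀+c₁+c₂≡0 = x*y≡0⇒x≡0 (c f0 +K c f1 +K c f2) √2 √2≢0 (trans (*K-comm (c f0 +K c f1 +K c f2) √2) (trans (sym height-expansion) (cong ℤtoK t₁≡0)))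
    c₀+c₁≡0 : c f0 +K c f1 ≡ 0K
    c₀+c₁≡0 = proj₁ (NonNeg-+K≡0 (NonNeg-+K (c≥0 f0) (c≥0 f1)) (c≥0 f2) c₀+c₁+c₂≡0)
    c₀₁₂≡0 : ∀ j → j ≢ f3 → c j ≡ 0K
    c₀₁₂≡0 zero _ = proj₁ (NonNeg-+K≡0 (c≥0 f0) (c≥0 f1) c₀+c₁≡0)
    c₀₁₂≡0 (suc zero) _ = proj₂ (NonNeg-+K≡0 (c≥0 f0) (c≥0 f1) c₀+c₁≡0)
    c₀₁₂≡0 (suc (suc zero)) _ = proj₂ (NonNeg-+K≡0 (NonNeg-+K (c≥0 f0) (c≥0 f1)) (c≥0 f2) c₀+c₁+c₂≡0)
    c₀₁₂≡0 (suc (suc (suc zero))) j≢3 = ⊥-elim (j≢3 refl)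
    on-gen₃ : ∀ i → ℤtoK (t i) ≡ gen f3 i *K c f3
    on-gen₃ i = trans (t≡Gc i) (sum-single _ f3 λ j j≢3 → trans (cong (genMatrix i j *K_) (c₀₁₂≡0 j j≢3)) (*K-zeroʳ (genMatrix i j)))
    negate : ∀ w → w ≡ -K (gen f3 f2 *K w)
    negate = solve-∀ K-ring
    c₃-rational : c f3 ≡ fromℚ (ℚ.- fromℤ (t f2))
    c₃-rational = trans (negate (c f3)) (cong -K_ (sym (on-gen₃ f2)))
    c≡0 : ∀ j → c j ≡ 0K
    c≡0 j with j Fin.≟ f3
    ... | no j≢3 = c₀₁₂≡0 j j≢3
    ... | yes refl = trans c₃-rational (cong fromℚ (√2*fromℚ≡fromℚ⇒≡0 (trans (cong (√2 *K_) (sym c₃-rational)) (sym (on-gen₃ f3)))))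

term : ℕ × Mat × Vec4 ℤ → Vec4 ℤ
term (_ , T , r) = T ·ℤ r

S-height : ∀ {v} → InS v → ∃ λ n → v f1 ≡ + n
S-height {v} v∈S = ∣ v f1 ∣ , sym (ℤP.0≤i⇒+∣i∣≡i (S-height-nonNeg {v} v∈S))

scaled-S-vanishes : ∀ {v} l n → InS v → v f1 ≡ + n → l ℕ.* n ≡ 0 → ∀ i → + l ℤ.* v i ≡ + 0
scaled-S-vanishes {v} l n v∈S v₁≡n ln≡0 i with ℕP.m*n≡0⇒m≡0∨n≡0 l ln≡0
... | inj₁ refl = refl
... | inj₂ refl = trans (cong (+ l ℤ.*_) (S-height-zero {v} v∈S v₁≡n i)) (ℤP.*-zeroʳ (+ l))

sumTerms-height : ∀ {ts} → All (InS ∘ term) ts → ∃ λ m → sumTerms ts f1 ≡ + m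
sumTerms-height [] = 0 , refl
sumTerms-height {(l , T , r) ∷ ts} (v∈S ∷ rest) =
  l ℕ.* proj₁ height ℕ.+ proj₁ rest-height ,
  cong₂ ℤ._+_ (trans (cong (+ l ℤ.*_) (proj₂ height)) (sym (ℤP.pos-* l (proj₁ height)))) (proj₂ rest-height)
  where
  height = S-height {T ·ℤ r} v∈S
  rest-height = sumTerms-height rest

sumTerms-vanishes : ∀ {ts} → All (InS ∘ term) ts → sumTerms ts f1 ≡ + 0 → ∀ i → sumTerms ts i ≡ + 0
sumTerms-vanishes [] _ i = refl
sumTerms-vanishes {(l , T , r) ∷ ts} (v∈S ∷ rest) Σ₁≡0 i =
  cong₂ ℤ._+_ (scaled-S-vanishes {T ·ℤ r} l n v∈S v₁≡n (ℕP.m+n≡0⇒m≡0 _ total≡0) i)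
              (sumTerms-vanishes rest (trans rest₁≡m (cong +_ (ℕP.m+n≡0⇒n≡0 _ total≡0))) i)
  where
  n : ℕ
  n = proj₁ (S-height {T ·ℤ r} v∈S)
  v₁≡n : (T ·ℤ r) f1 ≡ + n
  v₁≡n = proj₂ (S-height {T ·ℤ r} v∈S)
  m : ℕ
  m = proj₁ (sumTerms-height rest)
  rest₁≡m : sumTerms ts f1 ≡ + m
  rest₁≡m = proj₂ (sumTerms-height rest)
  total≡0 : l ℕ.* n ℕ.+ m ≡ 0
  total≡0 = ℤP.+-injective (trans (cong₂ ℤ._+_ (trans (ℤP.pos-* l n) (cong (+ l ℤ.*_) (sym v₁≡n))) (sym rest₁≡m)) Σ₁≡0)

-- Heights of elements of S are natural numbers and only 0 has height 0,
-- so a sum of height 1 is a single term with multiplicity 1.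
unit-height-term : ∀ {ts} {s : Vec4 ℤ} → All (InS ∘ term) ts → (∀ i → s i ≡ sumTerms ts i) → s f1 ≡ + 1 →
                   Any (λ t → ∀ i → s i ≡ term t i) ts
unit-height-term {[]} [] s≡Σ s₁≡1 = contradiction (trans (sym (s≡Σ f1)) s₁≡1) λ ()
unit-height-term {(l , T , r) ∷ ts} {s} (v∈S ∷ rest) s≡Σ s₁≡1 = split m rest₁≡m total≡1
  where
  v : Vec4 ℤ
  v = T ·ℤ r
  n : ℕ
  n = proj₁ (S-height {v} v∈S)
  v₁≡n : v f1 ≡ + n
  v₁≡n = proj₂ (S-height {v} v∈S)
  m : ℕ
  m = proj₁ (sumTerms-height rest)
  rest₁≡m : sumTerms ts f1 ≡ + m
  rest₁≡m = proj₂ (sumTerms-height rest)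
  total≡1 : l ℕ.* n ℕ.+ m ≡ 1
  total≡1 = ℤP.+-injective (begin
    + (l ℕ.* n ℕ.+ m)                 ≡⟨ cong₂ ℤ._+_ (trans (ℤP.pos-* l n) (cong (+ l ℤ.*_) (sym v₁≡n))) (sym rest₁≡m) ⟩
    + l ℤ.* v f1 ℤ.+ sumTerms ts f1   ≡⟨ sym (s≡Σ f1) ⟩
    s f1                              ≡⟨ s₁≡1 ⟩
    + 1                               ∎)
    where open ≡-Reasoning
  split : ∀ m → sumTerms ts f1 ≡ + m → l ℕ.* n ℕ.+ m ≡ 1 → Any (λ t → ∀ i → s i ≡ term t i) ((l , T , r) ∷ ts)
  split zero rest₁≡0 ln+0≡1 = here λ i → begin
    s i                                 ≡⟨ s≡Σ i ⟩
    + l ℤ.* v i ℤ.+ sumTerms ts i       ≡⟨ cong₂ (λ l t → + l ℤ.* v i ℤ.+ t) l≡1 (sumTerms-vanishes rest rest₁≡0 i) ⟩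
    + 1 ℤ.* v i ℤ.+ + 0                 ≡⟨ ℤP.+-identityʳ _ ⟩
    + 1 ℤ.* v i                         ≡⟨ ℤP.*-identityˡ (v i) ⟩
    v i                                 ∎
    where
    open ≡-Reasoning
    l≡1 : l ≡ 1
    l≡1 = ℕP.m*n≡1⇒m≡1 l n (trans (sym (ℕP.+-identityʳ _)) ln+0≡1)
  split (suc m) rest₁≡1+m ln+1+m≡1 = there (unit-height-term rest s≡rest (trans (s≡rest f1) rest₁≡1))
    where
    ln+m≡0 : l ℕ.* n ℕ.+ m ≡ 0
    ln+m≡0 = ℕP.suc-injective (trans (sym (ℕP.+-suc (l ℕ.* n) m)) ln+1+m≡1)
    rest₁≡1 : sumTerms ts f1 ≡ + 1
    rest₁≡1 = trans rest₁≡1+m (cong (+_ ∘ suc) (ℕP.m+n≡0⇒n≡0 (l ℕ.* n) ln+m≡0))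
    s≡rest : ∀ i → s i ≡ sumTerms ts i
    s≡rest i = begin
      s i                                 ≡⟨ s≡Σ i ⟩
      + l ℤ.* v i ℤ.+ sumTerms ts i       ≡⟨ cong (ℤ._+ sumTerms ts i) (scaled-S-vanishes {v} l n v∈S v₁≡n (ℕP.m+n≡0⇒m≡0 _ ln+m≡0) i) ⟩
      + 0 ℤ.+ sumTerms ts i               ≡⟨ ℤP.+-identityˡ _ ⟩
      sumTerms ts i                       ∎
      where open ≡-Reasoning

-- Identities in ℚ(√2) with rational unknowns

module ℚ-Poly = +-*-Solver
open ℚ-Poly using (Polynomial; con; _:+_; _:*_; :-_; _:-_; _:=_; solve)

-- Pairs of rational polynomials, combined exactly as _+K_ and _*K_ combine components,
-- so that identities in K with rational unknowns reduce to two polynomial identities.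
KPolynomial : ℕ → Set
KPolynomial m = Polynomial m × Polynomial m

private
  variable m : ℕ

_⊕_ : KPolynomial m → KPolynomial m → KPolynomial m
(p , q) ⊕ (p' , q') = p :+ p' , q :+ q'

_⊗_ : KPolynomial m → KPolynomial m → KPolynomial m
(p , q) ⊗ (p' , q') = p :* p' :+ con 2ℚ :* q :* q' , p :* q' :+ q :* p'

constᴷ : K → KPolynomial m
constᴷ x = con (re x) , con (ir x)

coordᴾ : Fin 4 → (Fin 4 → KPolynomial m) → KPolynomial m
coordᴾ j x = foldr _⊕_ (constᴷ 0K) (λ i → constᴷ (dual j i) ⊗ x i)

⟦_⟧ᴷ : KPolynomial m → Vec ℚ m → K
⟦ p , q ⟧ᴷ ρ = ℚ-Poly.⟦ p ⟧ ρ +√2· ℚ-Poly.⟦ q ⟧ ρ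

normᴾ : KPolynomial m → Polynomial m
normᴾ (p , q) = p :* p :- con 2ℚ :* q :* q

-- A Pell family in S_C

3ℚ ⅛ : ℚ
3ℚ = + 3 ℚ./ 1
⅛ = + 1 ℚ./ 8

-- Solutions of a² = 2b² + 1, generated from (3, 2) by the unit 3 + 2√2.
pell : ℕ → ℕ × ℕ
pell zero = 3 , 2
pell (suc n) = let (a , b) = pell n in 3 ℕ.* a ℕ.+ 4 ℕ.* b , 2 ℕ.* a ℕ.+ 3 ℕ.* b

pellA pellB : ℕ → ℕ
pellA = proj₁ ∘ pell
pellB = proj₂ ∘ pell

pell-equation : ∀ n → pellA n ℕ.* pellA n ≡ 2 ℕ.* (pellB n ℕ.* pellB n) ℕ.+ 1
pell-equation zero = refl
pell-equation (suc n) = ℕP.+-cancelʳ-≡ (2 ℕ.* (b ℕ.* b)) _ _ (begin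
  a' ℕ.* a' ℕ.+ 2 ℕ.* (b ℕ.* b)                    ≡⟨ step a b ⟩
  2 ℕ.* (b' ℕ.* b') ℕ.+ a ℕ.* a                    ≡⟨ cong (2 ℕ.* (b' ℕ.* b') ℕ.+_) (pell-equation n) ⟩
  2 ℕ.* (b' ℕ.* b') ℕ.+ (2 ℕ.* (b ℕ.* b) ℕ.+ 1)    ≡⟨ shuffle (2 ℕ.* (b' ℕ.* b')) (2 ℕ.* (b ℕ.* b)) ⟩
  2 ℕ.* (b' ℕ.* b') ℕ.+ 1 ℕ.+ 2 ℕ.* (b ℕ.* b)      ∎)
  where
  open ≡-Reasoning
  a b a' b' : ℕ
  a = pellA n
  b = pellB n
  a' = pellA (suc n)
  b' = pellB (suc n)
  step : ∀ a b → (3 ℕ.* a ℕ.+ 4 ℕ.* b) ℕ.* (3 ℕ.* a ℕ.+ 4 ℕ.* b) ℕ.+ 2 ℕ.* (b ℕ.* b)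
               ≡ 2 ℕ.* ((2 ℕ.* a ℕ.+ 3 ℕ.* b) ℕ.* (2 ℕ.* a ℕ.+ 3 ℕ.* b)) ℕ.+ a ℕ.* a
  step = ℕ-Solver.solve-∀
  shuffle : ∀ x y → x ℕ.+ (y ℕ.+ 1) ≡ x ℕ.+ 1 ℕ.+ y
  shuffle = ℕ-Solver.solve-∀

pellA≥3 : ∀ n → 3 ℕ.≤ pellA n
pellA≥3 zero = ℕP.≤-refl
pellA≥3 (suc n) = ℕP.≤-trans (pellA≥3 n) (ℕP.≤-trans (ℕP.m≤m+n (pellA n) _) (ℕP.m≤m+n (3 ℕ.* pellA n) (4 ℕ.* pellB n)))

pellA-increasing : ∀ n → pellA n ℕ.< pellA (suc n)
pellA-increasing n = ℕP.<-≤-trans (ℕP.m<m+n (pellA n) (ℕP.≤-trans (ℕP.<-≤-trans (s≤s z≤n) (pellA≥3 n)) (ℕP.m≤m+n (pellA n) _)))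
                                   (ℕP.m≤m+n (3 ℕ.* pellA n) (4 ℕ.* pellB n))

pellA-mono-< : ∀ {m n} → m ℕ.< n → pellA m ℕ.< pellA n
pellA-mono-< {m} {suc n} m<1+n with ℕP.m≤n⇒m<n∨m≡n (ℕP.≤-pred m<1+n)
... | inj₁ m<n = ℕP.<-trans (pellA-mono-< m<n) (pellA-increasing n)
... | inj₂ refl = pellA-increasing m

pellA-injective : ∀ {m n} → pellA m ≡ pellA n → m ≡ n
pellA-injective {m} {n} eq with ℕP.<-cmp m n
... | tri< m<n _ _ = contradiction eq (ℕP.<⇒≢ (pellA-mono-< m<n))
... | tri≈ _ m≡n _ = m≡n
... | tri> _ _ n<m = contradiction (sym eq) (ℕP.<⇒≢ (pellA-mono-< n<m))

family : ℕ → Vec4 ℤ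
family n zero = + 0
family n (suc zero) = + 1
family n (suc (suc zero)) = ℤ.- (+ pellB n)
family n (suc (suc (suc zero))) = + pellA n

-- With a = c + 3 the family is (0, 1, −b, c + 3); these are its rational coordinates and its
-- coordinates in the basis gen, as polynomials in b and c.
familyᴾ : Polynomial m → Polynomial m → Fin 4 → Polynomial m
familyᴾ b c zero = con 0ℚ
familyᴾ b c (suc zero) = con 1ℚ
familyᴾ b c (suc (suc zero)) = :- b
familyᴾ b c (suc (suc (suc zero))) = c :+ con 3ℚ

familyCoordᴾ : Polynomial m → Polynomial m → Fin 4 → KPolynomial m
familyCoordᴾ b c zero = con ½ :* b , :- (con ¼ :* (c :+ con 2ℚ))
familyCoordᴾ b c (suc zero) = :- (con ½ :* b) , con ¼ :* (c :+ con 3ℚ)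
familyCoordᴾ b c (suc (suc zero)) = con 0ℚ , con ¼
familyCoordᴾ b c (suc (suc (suc zero))) = con ½ :* b , con ¼ :* (c :+ con 1ℚ)

pellDefectᴾ : Polynomial m → Polynomial m → Polynomial m
pellDefectᴾ b c = con 2ℚ :* b :* b :+ con 1ℚ :- (c :+ con 3ℚ) :* (c :+ con 3ℚ)

module _ (n : ℕ) where
  B C : ℚ
  B = fromℤ (+ pellB n)
  C = fromℤ (+ (pellA n ℕ.∸ 3))

  ρ : Vec ℚ 2
  ρ = B ∷ C ∷ []

  familyCoord : Fin 4 → K
  familyCoord j = ⟦ familyCoordᴾ (ℚ-Poly.var zero) (ℚ-Poly.var (suc zero)) j ⟧ᴷ ρ

  A≡C+3 : fromℤ (+ pellA n) ≡ C ℚ.+ 3ℚ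
  A≡C+3 = begin
    fromℤ (+ pellA n)                          ≡⟨ cong (fromℤ ∘ +_) (ℕP.m∸n+n≡m (pellA≥3 n)) ⟨
    fromℤ (+ (pellA n ℕ.∸ 3) ℤ.+ + 3)          ≡⟨ fromℤ-+ (+ (pellA n ℕ.∸ 3)) (+ 3) ⟩
    C ℚ.+ 3ℚ                                   ∎
    where open ≡-Reasoning

  embed-family : ∀ i → embed (family n) i ≡ fromℚ (ℚ-Poly.⟦ familyᴾ (ℚ-Poly.var zero) (ℚ-Poly.var (suc zero)) i ⟧ ρ)
  embed-family zero = refl
  embed-family (suc zero) = refl
  embed-family (suc (suc zero)) = cong fromℚ (fromℤ-neg (pellB n))
  embed-family (suc (suc (suc zero))) = cong fromℚ A≡C+3

  coord-family : ∀ j → coord (embed (family n)) j ≡ familyCoord j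
  coord-family j = trans (*ᵛ-congʳ dual embed-family j) (by-components j)
    where
    by-components : ∀ j → coord (λ i → fromℚ (ℚ-Poly.⟦ familyᴾ (ℚ-Poly.var zero) (ℚ-Poly.var (suc zero)) i ⟧ ρ)) j ≡ familyCoord j
    by-components zero = cong₂ _+√2·_
      (solve 2 (λ b c → proj₁ (coordᴾ f0 (λ i → familyᴾ b c i , con 0ℚ)) := proj₁ (familyCoordᴾ b c f0)) refl B C)
      (solve 2 (λ b c → proj₂ (coordᴾ f0 (λ i → familyᴾ b c i , con 0ℚ)) := proj₂ (familyCoordᴾ b c f0)) refl B C)
    by-components (suc zero) = cong₂ _+√2·_
      (solve 2 (λ b c → proj₁ (coordᴾ f1 (λ i → familyᴾ b c i , con 0ℚ)) := proj₁ (familyCoordᴾ b c f1)) refl B C)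
      (solve 2 (λ b c → proj₂ (coordᴾ f1 (λ i → familyᴾ b c i , con 0ℚ)) := proj₂ (familyCoordᴾ b c f1)) refl B C)
    by-components (suc (suc zero)) = cong₂ _+√2·_
      (solve 2 (λ b c → proj₁ (coordᴾ f2 (λ i → familyᴾ b c i , con 0ℚ)) := proj₁ (familyCoordᴾ b c f2)) refl B C)
      (solve 2 (λ b c → proj₂ (coordᴾ f2 (λ i → familyᴾ b c i , con 0ℚ)) := proj₂ (familyCoordᴾ b c f2)) refl B C)
    by-components (suc (suc (suc zero))) = cong₂ _+√2·_
      (solve 2 (λ b c → proj₁ (coordᴾ f3 (λ i → familyᴾ b c i , con 0ℚ)) := proj₁ (familyCoordᴾ b c f3)) refl B C)
      (solve 2 (λ b c → proj₂ (coordᴾ f3 (λ i → familyᴾ b c i , con 0ℚ)) := proj₂ (familyCoordᴾ b c f3)) refl B C)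

  pell-defect : ℚ-Poly.⟦ pellDefectᴾ (ℚ-Poly.var zero) (ℚ-Poly.var (suc zero)) ⟧ ρ ≡ 0ℚ
  pell-defect = begin
    2ℚ ℚ.* B ℚ.* B ℚ.+ 1ℚ ℚ.- (C ℚ.+ 3ℚ) ℚ.* (C ℚ.+ 3ℚ)     ≡⟨ cong₂ (λ x y → x ℚ.+ 1ℚ ℚ.- y ℚ.* y) (sym (ℚP.*-assoc 2ℚ B B)) A≡C+3 ⟨
    2ℚ ℚ.* (B ℚ.* B) ℚ.+ 1ℚ ℚ.- A ℚ.* A                   ≡⟨ cong (λ y → 2ℚ ℚ.* (B ℚ.* B) ℚ.+ 1ℚ ℚ.- y) pell-ℚ ⟩
    2ℚ ℚ.* (B ℚ.* B) ℚ.+ 1ℚ ℚ.- (2ℚ ℚ.* (B ℚ.* B) ℚ.+ 1ℚ)  ≡⟨ ℚP.+-inverseʳ (2ℚ ℚ.* (B ℚ.* B) ℚ.+ 1ℚ) ⟩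
    0ℚ                                                    ∎
    where
    open ≡-Reasoning
    A : ℚ
    A = fromℤ (+ pellA n)
    pell-ℚ : A ℚ.* A ≡ 2ℚ ℚ.* (B ℚ.* B) ℚ.+ 1ℚ
    pell-ℚ = begin
      A ℚ.* A                                              ≡⟨ fromℤ-* (+ pellA n) (+ pellA n) ⟨
      fromℤ (+ pellA n ℤ.* + pellA n)                      ≡⟨ cong fromℤ (ℤP.pos-* (pellA n) (pellA n)) ⟨
      fromℤ (+ (pellA n ℕ.* pellA n))                      ≡⟨ cong (fromℤ ∘ +_) (pell-equation n) ⟩
      fromℤ (+ (2 ℕ.* (pellB n ℕ.* pellB n)) ℤ.+ + 1)      ≡⟨ fromℤ-+ (+ (2 ℕ.* (pellB n ℕ.* pellB n))) (+ 1) ⟩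
      fromℤ (+ (2 ℕ.* (pellB n ℕ.* pellB n))) ℚ.+ 1ℚ       ≡⟨ cong (λ z → fromℤ z ℚ.+ 1ℚ) (trans (ℤP.pos-* 2 (pellB n ℕ.* pellB n)) (cong (+ 2 ℤ.*_) (ℤP.pos-* (pellB n) (pellB n)))) ⟩
      fromℤ (+ 2 ℤ.* (+ pellB n ℤ.* + pellB n)) ℚ.+ 1ℚ     ≡⟨ cong (ℚ._+ 1ℚ) (trans (fromℤ-* (+ 2) (+ pellB n ℤ.* + pellB n)) (cong (2ℚ ℚ.*_) (fromℤ-* (+ pellB n) (+ pellB n)))) ⟩
      2ℚ ℚ.* (B ℚ.* B) ℚ.+ 1ℚ                              ∎

  private
    modulo-pell : ∀ {x} p k → x ≡ p ℚ.+ k ℚ.* ℚ-Poly.⟦ pellDefectᴾ (ℚ-Poly.var zero) (ℚ-Poly.var (suc zero)) ⟧ ρ →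
                  0ℚ ℚ.≤ p → 0ℚ ℚ.≤ x
    modulo-pell {x} p k x≡ 0≤p = subst (0ℚ ℚ.≤_) (sym (begin
      x                    ≡⟨ x≡ ⟩
      p ℚ.+ k ℚ.* _        ≡⟨ cong (λ d → p ℚ.+ k ℚ.* d) pell-defect ⟩
      p ℚ.+ k ℚ.* 0ℚ       ≡⟨ cong (p ℚ.+_) (ℚP.*-zeroʳ k) ⟩
      p ℚ.+ 0ℚ             ≡⟨ ℚP.+-identityʳ p ⟩
      p                    ∎)) 0≤p
      where open ≡-Reasoning
    B≥0 : 0ℚ ℚ.≤ B
    B≥0 = fromℤ-nonNeg (pellB n)
    C+k≥0 : ∀ k → 0ℚ ℚ.≤ k → 0ℚ ℚ.≤ C ℚ.+ k
    C+k≥0 k 0≤k = +-nonNeg (fromℤ-nonNeg (pellA n ℕ.∸ 3)) 0≤k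

  familyCoord-nonNeg : ∀ j → NonNeg (familyCoord j)
  familyCoord-nonNeg zero = re-dominant (*-nonNeg {½} {B} (ℚP.≤ᵇ⇒≤ tt) B≥0)
    (modulo-pell (¼ ℚ.* (C ℚ.+ 2ℚ)) ⅛ (solve 2 (λ b c → normᴾ (familyCoordᴾ b c f0) := con ¼ :* (c :+ con 2ℚ) :+ con ⅛ :* pellDefectᴾ b c) refl B C)
                 (*-nonNeg {¼} (ℚP.≤ᵇ⇒≤ tt) (C+k≥0 2ℚ (ℚP.≤ᵇ⇒≤ tt))))
  familyCoord-nonNeg (suc zero) = ir-dominant (*-nonNeg {¼} (ℚP.≤ᵇ⇒≤ tt) (C+k≥0 3ℚ (ℚP.≤ᵇ⇒≤ tt)))
    (modulo-pell ⅛ (ℚ.- ⅛) (solve 2 (λ b c → :- normᴾ (familyCoordᴾ b c f1) := con ⅛ :+ :- con ⅛ :* pellDefectᴾ b c) refl B C)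
                 (ℚP.≤ᵇ⇒≤ tt))
  familyCoord-nonNeg (suc (suc zero)) = ir-dominant (ℚP.≤ᵇ⇒≤ tt) (ℚP.≤ᵇ⇒≤ tt)
  familyCoord-nonNeg (suc (suc (suc zero))) = re-dominant (*-nonNeg {½} {B} (ℚP.≤ᵇ⇒≤ tt) B≥0)
    (modulo-pell (⅛ ℚ.* (4ℚ ℚ.* C ℚ.+ 7ℚ)) ⅛ (solve 2 (λ b c → normᴾ (familyCoordᴾ b c f3) := con ⅛ :* (con 4ℚ :* c :+ con 7ℚ) :+ con ⅛ :* pellDefectᴾ b c) refl B C)
                 (*-nonNeg {⅛} (ℚP.≤ᵇ⇒≤ tt) (+-nonNeg (*-nonNeg {4ℚ} (ℚP.≤ᵇ⇒≤ tt) (fromℤ-nonNeg (pellA n ℕ.∸ 3))) (ℚP.≤ᵇ⇒≤ tt))))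
    where
    4ℚ 7ℚ : ℚ
    4ℚ = + 4 ℚ./ 1
    7ℚ = + 7 ℚ./ 1

familyCoord-ratio-injective : ∀ m n →
  familyCoord m f0 *K familyCoord n f1 ≡ familyCoord n f0 *K familyCoord m f1 → m ≡ n
familyCoord-ratio-injective m n cross≡ = pellA-injective (begin
  pellA m                    ≡⟨ ℕP.m∸n+n≡m (pellA≥3 m) ⟨
  pellA m ℕ.∸ 3 ℕ.+ 3        ≡⟨ cong (ℕ._+ 3) (ℤP.+-injective (fromℤ-injective Cm≡Cn)) ⟩
  pellA n ℕ.∸ 3 ℕ.+ 3        ≡⟨ ℕP.m∸n+n≡m (pellA≥3 n) ⟩
  pellA n                    ∎)
  where
  open ≡-Reasoning
  difference : re (familyCoord m f0 *K familyCoord n f1) ℚ.- re (familyCoord n f0 *K familyCoord m f1) ≡ ⅛ ℚ.* (C n ℚ.- C m)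
  difference = solve 4 (λ bm cm bn cn → proj₁ (familyCoordᴾ bm cm f0 ⊗ familyCoordᴾ bn cn f1)
                                     :- proj₁ (familyCoordᴾ bn cn f0 ⊗ familyCoordᴾ bm cm f1) := con ⅛ :* (cn :- cm))
                       refl (B m) (C m) (B n) (C n)
  ⅛[Cn-Cm]≡0 : ⅛ ℚ.* (C n ℚ.- C m) ≡ 0ℚ
  ⅛[Cn-Cm]≡0 = trans (sym difference) (trans (cong (λ x → x ℚ.- re (familyCoord n f0 *K familyCoord m f1)) (cong re cross≡))
                                             (ℚP.+-inverseʳ (re (familyCoord n f0 *K familyCoord m f1))))
  Cm≡Cn : C m ≡ C n
  Cm≡Cn = sym (ℚ-x-y≡0⇒x≡y (C n) (C m) (ℚ-p*q≡0⇒p≡0 (C n ℚ.- C m) ⅛ (λ ()) (trans (ℚP.*-comm (C n ℚ.- C m) ⅛) ⅛[Cn-Cm]≡0)))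

family-InS : ∀ n → InS (family n)
family-InS n = coord-nonNeg⇒InC λ j → subst NonNeg (sym (coord-family n j)) (familyCoord-nonNeg n j)

subst-Signature : ∀ {M κ₀ κ₁ κ₂ κ₀' κ₁' κ₂'} → κ₀ ≡ κ₀' → κ₁ ≡ κ₁' → κ₂ ≡ κ₂' → Signature M κ₀ κ₁ κ₂ → Signature M κ₀' κ₁' κ₂'
subst-Signature refl refl refl σ = σ

module _ (rg : RGFinGen) where
  open RGFinGen rg

  -- family n = T · r for some T ∈ G and r ∈ R, seen through the basis gen.
  record Factorisation (n : ℕ) : Set where
    field
      r         : Vec4 ℤ
      r∈R       : r ∈ R
      M         : KMatrix 4
      κ₀ κ₁ κ₂  : Fin 4
      signature : Signature M κ₀ κ₁ κ₂
      coords    : ∀ j → familyCoord n j ≡ (M *ᵛ coord (embed r)) j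

  factorise : ∀ n → Factorisation n
  factorise n = record
    { r = r ; r∈R = r∈R ; M = inGenBasis T
    ; κ₀ = κ f0 ; κ₁ = κ f1 ; κ₂ = κ f2
    ; signature = monomial-signature mono (inGenBasis-conj T)
    ; coords = coords }
    where
    terms = span (family n) (family-InS n)
    ts : List (ℕ × Mat × Vec4 ℤ)
    ts = proj₁ terms
    memberships : All (λ t → InGroup gens (proj₁ (proj₂ t)) × proj₂ (proj₂ t) ∈ R) ts
    memberships = proj₁ (proj₂ terms)
    single : Any.Any (λ t → ∀ i → family n i ≡ term t i) ts
    single = unit-height-term (All.map (λ {(_ , T , r)} (T∈G , r∈R) → GS⊆S T T∈G r (All.lookup R⊆S r∈R)) memberships)
                              (proj₂ (proj₂ terms)) refl
    T : Mat
    T = proj₁ (proj₂ (Any.lookup single))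
    r : Vec4 ℤ
    r = proj₂ (proj₂ (Any.lookup single))
    found : (InGroup gens T × r ∈ R) × (∀ i → family n i ≡ (T ·ℤ r) i)
    found = All.lookupAny memberships single
    T∈G : InGroup gens T
    T∈G = proj₁ (proj₁ found)
    r∈R : r ∈ R
    r∈R = proj₂ (proj₁ found)
    mono : Monomial (inGenBasis T)
    mono = nonNeg-inverse⇒monomial (inGenBasis-nonNeg T (GC⊆C T T∈G)) (inGenBasis-inverse T (C⊆GC T T∈G))
    open Monomial mono using (κ)
    coords : ∀ j → familyCoord n j ≡ (inGenBasis T *ᵛ coord (embed r)) j
    coords j = begin
      familyCoord n j                        ≡⟨ coord-family n j ⟨
      coord (embed (family n)) j             ≡⟨ *ᵛ-congʳ dual (λ i → trans (cong ℤtoK (proj₂ found i)) (embed-·ℤ T r i)) j ⟩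
      coord (T ·K embed r) j                 ≡⟨ coord-·K T (embed r) j ⟩
      (inGenBasis T *ᵛ coord (embed r)) j    ∎
      where open ≡-Reasoning

  open Factorisation

  key : ℕ → Fin (length R ℕ.* (4 ℕ.* (4 ℕ.* 4)))
  key n = combine (Any.index (r∈R F)) (combine (κ₀ F) (combine (κ₁ F) (κ₂ F)))
    where F = factorise n

  key-injective : ∀ {m n} → key m ≡ key n → m ≡ n
  key-injective {m} {n} key≡ = familyCoord-ratio-injective m n (begin
    familyCoord m f0 *K familyCoord n f1    ≡⟨ cong₂ _*K_ (coords Fm f0) (coordsₙ f1) ⟩
    (M Fm *ᵛ v) f0 *K (M Fn *ᵛ v) f1        ≡⟨ signature-proportional (signature Fm) σn v ⟩
    (M Fn *ᵛ v) f0 *K (M Fm *ᵛ v) f1        ≡⟨ cong₂ _*K_ (coordsₙ f0) (coords Fm f1) ⟨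
    familyCoord n f0 *K familyCoord m f1    ∎)
    where
    open ≡-Reasoning
    Fm = factorise m
    Fn = factorise n
    split₁ = FinP.combine-injective (Any.index (r∈R Fm)) _ (Any.index (r∈R Fn)) _ key≡
    split₂ = FinP.combine-injective (κ₀ Fm) _ (κ₀ Fn) _ (proj₂ split₁)
    split₃ = FinP.combine-injective (κ₁ Fm) (κ₂ Fm) (κ₁ Fn) (κ₂ Fn) (proj₂ split₂)
    r≡ : r Fn ≡ r Fm
    r≡ = trans (lookup-index (r∈R Fn)) (trans (cong (List.lookup R) (sym (proj₁ split₁))) (sym (lookup-index (r∈R Fm))))
    σn : Signature (M Fn) (κ₀ Fm) (κ₁ Fm) (κ₂ Fm)
    σn = subst-Signature (sym (proj₁ split₂)) (sym (proj₁ split₃)) (sym (proj₂ split₃)) (signature Fn)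
    v : Vec4 K
    v = coord (embed (r Fm))
    coordsₙ : ∀ j → familyCoord n j ≡ (M Fn *ᵛ v) j
    coordsₙ j = trans (coords Fn j) (cong (λ r → (M Fn *ᵛ coord (embed r)) j) r≡)

proposition4p1 : ¬ RGFinGen
proposition4p1 rg = FinP.ℕ→Fin-notInjective (key rg) (key-injective rg)
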